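{- Let $a<b$ be positive odd integers. There exist infinite smooth words over $\{a,b\}$ that are infinite Lyndon words if and only if $a=1$. Moreover, when $a=1$, the infinite smooth words over $\{1,b\}$ that are infinite Lyndon words are exactly the two words $m_{\{1<b\}}$ and $\Delta^{ -1}_1(m_{\{1<b\}})$.
   Context: Words over $\{a,b\}$ are compared lexicographically with $a<b$. For a word $w$ over $\{a,b\}$ written as maximal blocks $\alpha_0^{i_0}\alpha_1^{i_1}\cdots$ ($\alpha_{k+1}\ne\alpha_k$, $i_k\ge1$), $\Delta(w)=i_0i_1\cdots$. An infinite word $w\in\{a,b\}^\omega$ is smooth if $\Delta^k(w)\in\{a,b\}^\omega$ for all $k\ge0$. $m_{\{a<b\}}$ is the lexicographically minimal infinite smooth word over $\{a,b\}$. For $\alpha\in\{a,b\}$ with complement $\overline\alpha$ (the other letter) and a word $u$ over positive integers, $\Delta^{ -1}_\alpha(u)=\alpha^{u[0]}\overline\alpha^{u[1]}\alpha^{u[2]}\cdots$. An infinite Lyndon word is an infinite word strictly smaller than each of its proper suffixes. -}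

module Defs where

open import Data.Nat using (ℕ; zero; suc; _+_; _*_; _<_; _≤_)
open import Data.Product using (Σ; _×_; ∃)
open import Data.Sum using (_⊎_)
open import Relation.Binary.PropositionalEquality using (_≡_)

Word : Set
Word = ℕ → ℕ

Odd : ℕ → Set
Odd n = ∃ λ k → n ≡ 2 * k + 1

_≈w_ : Word → Word → Set
w ≈w v = ∀ n → w n ≡ v n

OverAB : ℕ → ℕ → Word → Set
OverAB a b w = ∀ n → (w n ≡ a) ⊎ (w n ≡ b)

S : Word → ℕ → ℕ
S u zero = 0
S u (suc k) = S u k + u k

alt : ℕ → ℕ → ℕ → ℕ
alt α β zero = α
alt α β (suc k) = alt β α k

-- w = Δ^{-1}_α(u) with the other letter β:
-- w = α^{u 0} β^{u 1} α^{u 2} ...  (all u k ≥ 1, so blocks cover ℕ)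
InvDelta : ℕ → ℕ → Word → Word → Set
InvDelta α β u w =
  (∀ k → 1 ≤ u k) × (∀ k j → j < u k → w (S u k + j) ≡ alt α β k)

-- Δ(w) = u for a word w over {a,b} (a ≠ b): w decomposes into maximal
-- blocks of alternating letters starting with a or with b, of lengths u 0, u 1, ...
IsDelta : ℕ → ℕ → Word → Word → Set
IsDelta a b w u = InvDelta a b u w ⊎ InvDelta b a u w

-- smooth: Δ^k(w) ∈ {a,b}^ω for all k; W k plays the role of Δ^k(w)
Smooth : ℕ → ℕ → Word → Set
Smooth a b w = Σ (ℕ → Word) λ W →
  (W 0 ≈w w) × (∀ k → OverAB a b (W k)) × (∀ k → IsDelta a b (W k) (W (suc k)))

_<lex_ : Word → Word → Set
w <lex v = ∃ λ n → (∀ i → i < n → w i ≡ v i) × (w n < v n)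

_≤lex_ : Word → Word → Set
w ≤lex v = (w <lex v) ⊎ (w ≈w v)

Lyndon : Word → Set
Lyndon w = ∀ k → 1 ≤ k → w <lex (λ i → w (k + i))

IsMinSmooth : ℕ → ℕ → Word → Set
IsMinSmooth a b m = Smooth a b m × (∀ w → Smooth a b w → m ≤lex w)

module Submission where

-- All letters are odd, so every block of a smooth word starts at a position of the same parity as its
-- index, and Δ⁻¹ converts lexicographic order into an alternating order on run lengths and back.
--
-- If a ≥ 3, the runs of Δ(w) have length at least 3, and inspecting Δ(w) and Δ²(w) exhibits a suffix
-- of w smaller than w, so no smooth word is Lyndon.
--
-- If a = 1, let M = Δ⁻¹₁(ΔM), ΔM = Δ⁻¹_b(M) be the word whose Δ-tower has heads 1, b, 1, b, ….
-- Lyndon properties pass alternately up and down this tower, making M Lyndon; comparing a smooth word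
-- with M at the first level where the heads of the towers differ shows that M is the minimal smooth word.
-- For a smooth Lyndon word w the same transfers force the heads of the tower of w, or of Δ(w) when it
-- starts with 1, to alternate 1, b, 1, b, …; a tower is determined by its heads, so w = M or Δ⁻¹₁(M).

open import Defs
open import Data.Nat using (ℕ; zero; suc; _+_; _*_; _∸_; _<_; _≤_; z≤n; s≤s; _<?_; _≟_)
open import Data.Nat.Properties
open import Data.Nat.Solver using (module +-*-Solver)
open import Data.Nat.Induction using (<-rec)
open import Data.Bool using (Bool; true; false; not; if_then_else_)
open import Data.Bool.Properties using (not-involutive; not-injective)
open import Data.Product using (Σ; _×_; _,_; proj₁; proj₂; ∃)
open import Data.Sum using (_⊎_; inj₁; inj₂)
open import Data.Empty using (⊥; ⊥-elim)
open import Relation.Nullary using (¬_; yes; no; Dec)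
open import Relation.Binary using (tri<; tri≈; tri>)
open import Relation.Binary.PropositionalEquality
open import Function.Bundles using (_⇔_; mk⇔)

open +-*-Solver using (solve; _:+_; _:=_)

true≢false : true ≢ false
true≢false ()

even : ℕ → Bool
even zero = true
even (suc n) = not (even n)

even-suc : ∀ i {c} → even i ≡ c → even (suc i) ≡ not c
even-suc i = cong not

even-suc⁻¹ : ∀ i → even (suc i) ≡ false → even i ≡ true
even-suc⁻¹ i = not-injective

odd-suc⁻¹ : ∀ i → even (suc i) ≡ true → even i ≡ false
odd-suc⁻¹ i = not-injective

even-+-odd : ∀ m n → even n ≡ false → even (m + n) ≡ not (even m)
even-+-odd zero n e = e
even-+-odd (suc m) n e = cong not (even-+-odd m n e)

even-+-even : ∀ m n → even n ≡ true → even (m + n) ≡ even m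
even-+-even zero n e = e
even-+-even (suc m) n e = cong not (even-+-even m n e)

even-+-cancelˡ : ∀ s t → even s ≡ true → even (s + t) ≡ even t
even-+-cancelˡ s t es = trans (cong even (+-comm s t)) (even-+-even t s es)

even-double : ∀ k → even (k + k) ≡ true
even-double zero = refl
even-double (suc k) rewrite +-suc k k = trans (not-involutive (even (k + k))) (even-double k)

Odd⇒¬even : ∀ {n} → Odd n → even n ≡ false
Odd⇒¬even (k , refl) rewrite even-+-odd (2 * k) 1 refl | +-identityʳ k | even-double k = refl

odd⇒≥1 : ∀ t → even t ≡ false → 1 ≤ t
odd⇒≥1 zero ()
odd⇒≥1 (suc t) _ = s≤s z≤n

even-pred : ∀ x → even x ≡ false → even (x ∸ 1) ≡ true
even-pred zero ()
even-pred (suc x) = even-suc⁻¹ x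

odd-≢1⇒≥3 : ∀ x → even x ≡ false → x ≢ 1 → 3 ≤ x
odd-≢1⇒≥3 zero () _
odd-≢1⇒≥3 (suc zero) _ ne = ⊥-elim (ne refl)
odd-≢1⇒≥3 (suc (suc zero)) () _
odd-≢1⇒≥3 (suc (suc (suc x))) _ _ = s≤s (s≤s (s≤s z≤n))

even-≢0⇒≥2 : ∀ k → even k ≡ true → k ≢ 0 → 2 ≤ k
even-≢0⇒≥2 zero e ne = ⊥-elim (ne refl)
even-≢0⇒≥2 (suc zero) () ne
even-≢0⇒≥2 (suc (suc k)) e ne = s≤s (s≤s z≤n)

half : ∀ l → ∃ λ i → (l ≡ i + i) ⊎ (l ≡ suc (i + i))
half zero = 0 , inj₁ refl
half (suc l) with half l
... | i , inj₁ e = i , inj₂ (cong suc e)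
... | i , inj₂ e = suc i , inj₁ (trans (cong suc e) (cong suc (sym (+-suc i i))))

pred+1 : ∀ x → 1 ≤ x → (x ∸ 1) + 1 ≡ x
pred+1 (suc x) _ = +-comm x 1

alt-by-parity : ∀ α β k → alt α β k ≡ (if even k then α else β)
alt-by-parity α β zero = refl
alt-by-parity α β (suc k) rewrite alt-by-parity β α k with even k
... | true = refl
... | false = refl

alt-even : ∀ α β i → even i ≡ true → alt α β i ≡ α
alt-even α β i e rewrite alt-by-parity α β i | e = refl

alt-odd : ∀ α β i → even i ≡ false → alt α β i ≡ β
alt-odd α β i e rewrite alt-by-parity α β i | e = refl

alt-+ : ∀ α β k i → alt (alt α β k) (alt β α k) i ≡ alt α β (k + i)
alt-+ α β zero i = refl
alt-+ α β (suc k) i = alt-+ β α k i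

alt-≢-suc : ∀ α β → α ≢ β → ∀ i → alt α β i ≢ alt α β (suc i)
alt-≢-suc α β ne zero = ne
alt-≢-suc α β ne (suc i) = alt-≢-suc β α (λ e → ne (sym e)) i

σ : ℕ → Word → Word
σ k x i = x (k + i)

_∷w_ : ℕ → Word → Word
(r ∷w U) zero = r
(r ∷w U) (suc i) = U i

∷-σ : ∀ (u : Word) k i → (u k ∷w σ (suc k) u) i ≡ σ k u i
∷-σ u k zero = cong u (sym (+-identityʳ k))
∷-σ u k (suc i) = cong u (sym (+-suc k i))

σ-+0 : ∀ (w : Word) m i → σ (m + 0) w i ≡ σ m w i
σ-+0 w m i = cong (λ z → w (z + i)) (+-identityʳ m)

Agree : Word → Word → ℕ → Set
Agree x y n = ∀ i → i < n → x i ≡ y i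

Agree-zero : ∀ {x y : Word} → Agree x y 0
Agree-zero _ ()

Agree-sym : ∀ {x y : Word} n → Agree x y n → Agree y x n
Agree-sym n f i i< = sym (f i i<)

first-difference : ∀ (U V : Word) N → (∀ i → i ≤ N → U i ≡ V i) ⊎ (∃ λ i → i ≤ N × Agree U V i × (U i ≢ V i))
first-difference U V zero with U 0 ≟ V 0
... | yes e = inj₁ (λ { zero _ → e })
... | no ne = inj₂ (0 , z≤n , Agree-zero , ne)
first-difference U V (suc N) with first-difference U V N
... | inj₂ (i , i≤ , fd , ne) = inj₂ (i , ≤-trans i≤ (n≤1+n N) , fd , ne)
... | inj₁ ag with U (suc N) ≟ V (suc N)
... | no ne = inj₂ (suc N , ≤-refl , (λ i i< → ag i (≤-pred i<)) , ne)
... | yes e = inj₁ agree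
  where
  agree : ∀ i → i ≤ suc N → U i ≡ V i
  agree i i≤ with m≤n⇒m<n∨m≡n i≤
  ... | inj₁ (s≤s i≤N) = ag i i≤N
  ... | inj₂ refl = e

first-difference-unique : ∀ {x y : Word} n m → Agree x y n → x n ≢ y n → Agree x y m → x m ≢ y m → n ≡ m
first-difference-unique n m f1 d1 f2 d2 with <-cmp n m
... | tri≈ _ e _ = e
... | tri< lt _ _ = ⊥-elim (d1 (f2 n lt))
... | tri> _ _ gt = ⊥-elim (d2 (f1 m gt))

<lex-at : ∀ {x y} d → x <lex y → Agree x y d → x d ≢ y d → x d < y d
<lex-at d (n , fd , lt) fd' ne with first-difference-unique n d fd (<⇒≢ lt) fd' ne
... | refl = lt

<lex-asym : ∀ {x y : Word} → x <lex y → y <lex x → ⊥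
<lex-asym {x} {y} (n1 , f1 , l1) (n2 , f2 , l2) with <-cmp n1 n2
... | tri< lt _ _ = <-irrefl refl (subst (x n1 <_) (f2 n1 lt) l1)
... | tri≈ _ refl _ = <-asym l1 l2
... | tri> _ _ gt = <-irrefl refl (subst (y n2 <_) (f1 n2 gt) l2)

Lyndon-cong : ∀ {x y : Word} → x ≈w y → Lyndon x → Lyndon y
Lyndon-cong {x} {y} e ly k k1 with ly k k1
... | n , fd , lt = n , (λ i i< → trans (sym (e i)) (trans (fd i i<) (e (k + i)))) , subst₂ _<_ (e n) (e (k + n)) lt

Smooth-cong : ∀ {a b x y} → x ≈w y → Smooth a b x → Smooth a b y
Smooth-cong x≈y (W , W0≈x , over , isDelta) = W , (λ i → trans (W0≈x i) (x≈y i)) , over , isDelta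

Lyndon-head : ∀ {a b x} → a < b → OverAB a b x → Lyndon x → x 0 ≡ a
Lyndon-head {a} {b} {x} a<b ov ly with ov 0
... | inj₁ e = e
... | inj₂ e with ly 1 (s≤s z≤n)
... | n , fd , lt = ⊥-elim (last (ov (1 + n)))
  where
  all-b : ∀ i → i ≤ n → x i ≡ b
  all-b zero _ = e
  all-b (suc i) si≤ = trans (sym (fd i si≤)) (all-b i (≤-trans (n≤1+n i) si≤))
  last : (x (1 + n) ≡ a) ⊎ (x (1 + n) ≡ b) → ⊥
  last (inj₁ e') = <-asym a<b (subst₂ _<_ (all-b n ≤-refl) e' lt)
  last (inj₂ e') = <-irrefl refl (subst₂ _<_ (all-b n ≤-refl) e' lt)

Positive : Word → Set
Positive U = ∀ k → 1 ≤ U k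

≤-S : ∀ U → Positive U → ∀ k → k ≤ S U k
≤-S U p zero = z≤n
≤-S U p (suc k) = subst (suc k ≤_) (+-comm (U k) (S U k)) (+-mono-≤ (p k) (≤-S U p k))

S-mono-≤ : ∀ U i j → i ≤ j → S U i ≤ S U j
S-mono-≤ U i zero z≤n = ≤-refl
S-mono-≤ U i (suc j) le with m≤n⇒m<n∨m≡n le
... | inj₂ refl = ≤-refl
... | inj₁ (s≤s lt) = ≤-trans (S-mono-≤ U i j lt) (m≤m+n (S U j) (U j))

S-+ : ∀ U k i → S U (k + i) ≡ S U k + S (σ k U) i
S-+ U k zero rewrite +-identityʳ k = sym (+-identityʳ (S U k))
S-+ U k (suc i) rewrite +-suc k i | S-+ U k i = +-assoc (S U k) (S (σ k U) i) (U (k + i))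

S-cong : ∀ U V i → Agree U V i → S U i ≡ S V i
S-cong U V zero fd = refl
S-cong U V (suc i) fd = cong₂ _+_ (S-cong U V i (λ l l<i → fd l (≤-trans l<i (n≤1+n i)))) (fd i ≤-refl)

S-∷ : ∀ r U i → S (r ∷w U) (suc i) ≡ r + S U i
S-∷ r U zero = sym (+-identityʳ r)
S-∷ r U (suc i) rewrite S-∷ r U i = +-assoc r (S U i) (U i)

S-ones : ∀ (v : Word) N → (∀ l → l < N → v l ≡ 1) → S v N ≡ N
S-ones v zero h = refl
S-ones v (suc N) h = trans (cong₂ _+_ (S-ones v N (λ l l< → h l (≤-trans l< (n≤1+n N)))) (h N ≤-refl)) (+-comm N 1)

S-+-ones : ∀ (u : Word) K N → (∀ l → l < N → u (K + l) ≡ 1) → S u (K + N) ≡ S u K + N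
S-+-ones u K zero h = trans (cong (S u) (+-identityʳ K)) (sym (+-identityʳ _))
S-+-ones u K (suc N) h rewrite +-suc K N =
  trans (cong₂ _+_ (S-+-ones u K N (λ l l< → h l (≤-trans l< (n≤1+n N)))) (h N ≤-refl))
        (trans (+-assoc (S u K) N 1) (cong (S u K +_) (+-comm N 1)))

OddRuns : Word → Set
OddRuns V = ∀ k → even (V k) ≡ false

even-S : ∀ U i → OddRuns U → even (S U i) ≡ even i
even-S U zero h = refl
even-S U (suc i) h = trans (even-+-odd (S U i) (U i) (h i)) (cong not (even-S U i h))

even-blockEnd : ∀ V i → OddRuns V → even (S V i + V i) ≡ not (even i)
even-blockEnd V i h = even-S V (suc i) h

∷-odd : ∀ {r} (U : Word) m → even r ≡ false → OddRuns U → OddRuns (r ∷w σ m U)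
∷-odd U m er h zero = er
∷-odd U m er h (suc k) = h (m + k)

InBlock : Word → ℕ → ℕ → Set
InBlock U q j = S U j ≤ q × q < S U j + U j

findBlock : ∀ U q n → q < S U n → ∃ λ j → InBlock U q j
findBlock U q zero ()
findBlock U q (suc n) lt with q <? S U n
... | yes l = findBlock U q n l
... | no nl = n , ≮⇒≥ nl , lt

blockOf : ∀ U → Positive U → ∀ q → ∃ λ j → InBlock U q j
blockOf U p q = findBlock U q (suc q) (≤-<-trans (≤-S U p q) (m<m+n (S U q) (p q)))

inBlock-unique : ∀ U q j k → InBlock U q j → InBlock U q k → j ≡ k
inBlock-unique U q j k (a1 , b1) (a2 , b2) with <-cmp j k
... | tri≈ _ e _ = e
... | tri< lt _ _ = ⊥-elim (<-irrefl refl (<-≤-trans b1 (≤-trans (S-mono-≤ U (suc j) k lt) a2)))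
... | tri> _ _ gt = ⊥-elim (<-irrefl refl (<-≤-trans b2 (≤-trans (S-mono-≤ U (suc k) j gt) a1)))

inBlock⇒offset : ∀ V q j → InBlock V q j → ∃ λ t → (q ≡ S V j + t) × (t < V j)
inBlock⇒offset V q j (le , lt) = (q ∸ S V j) , sym (m+[n∸m]≡n le) ,
  +-cancelˡ-< (S V j) _ _ (subst (_< S V j + V j) (sym (m+[n∸m]≡n le)) lt)

inBlock-unit : ∀ {U n k} → InBlock U n k → U k ≡ 1 → n ≡ S U k
inBlock-unit {U} {n} {k} (le , lt) Uk≡1 =
  ≤-antisym (≤-pred (subst (n <_) (trans (cong (S U k +_) Uk≡1) (+-comm (S U k) 1)) lt)) le

remainder : ∀ {t x} → t < x → Σ ℕ λ r → (t + r ≡ x) × (1 ≤ r)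
remainder {t} {x} t< = (x ∸ t) , m+[n∸m]≡n (<⇒≤ t<) ,
  +-cancelˡ-≤ t 1 (x ∸ t) (subst (_≤ t + (x ∸ t)) (+-comm 1 t) (subst (suc t ≤_) (sym (m+[n∸m]≡n (<⇒≤ t<))) t<))

-- A record copy of InvDelta: unlike the Σ-type, its indices can be inferred by unification.
record Runs (α β : ℕ) (U X : Word) : Set where
  constructor mkRuns
  field
    runs-pos : Positive U
    runs-letter : ∀ k t → t < U k → X (S U k + t) ≡ alt α β k
open Runs public

toRuns : ∀ {α β U X} → InvDelta α β U X → Runs α β U X
toRuns (p , v) = mkRuns p v

fromRuns : ∀ {α β U X} → Runs α β U X → InvDelta α β U X
fromRuns (mkRuns p v) = p , v

runs-letter-inBlock : ∀ {α β U X} → Runs α β U X → ∀ q j → InBlock U q j → X q ≡ alt α β j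
runs-letter-inBlock {U = U} r q j b with inBlock⇒offset U q j b
... | t , refl , lt = runs-letter r j t lt

runs-head : ∀ {α β U X} → Runs α β U X → X 0 ≡ α
runs-head r = runs-letter r 0 0 (runs-pos r 0)

runs-next : ∀ {α β U X} → Runs α β U X → ∀ i → X (S U i + U i) ≡ alt α β (suc i)
runs-next {α} {β} {U} {X} r i = subst (λ z → X z ≡ alt α β (suc i)) (+-identityʳ (S U (suc i)))
    (runs-letter r (suc i) 0 (runs-pos r (suc i)))

Runs-cong : ∀ {α β U U' X X'} → Runs α β U X → U ≈w U' → X ≈w X' → Runs α β U' X'
Runs-cong {α} {β} {U} {U'} {X} {X'} r eU eX = mkRuns (λ k → subst (1 ≤_) (eU k) (runs-pos r k)) letter
  where
  letter : ∀ k t → t < U' k → X' (S U' k + t) ≡ alt α β k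
  letter k t t< = trans (sym (eX _))
    (trans (cong (λ z → X (z + t)) (sym (S-cong U U' k (λ l _ → eU l))))
           (runs-letter r k t (subst (t <_) (sym (eU k)) t<)))

Runs-letters : ∀ {α β α' β' U X} → α ≡ α' → β ≡ β' → Runs α β U X → Runs α' β' U X
Runs-letters refl refl r = r

runs-split : ∀ {α β U V X Y} i → Runs α β U X → Runs α β V Y → Agree U V i → V i < U i →
  Agree X Y (S V i + V i) × (X (S V i + V i) ≡ alt α β i) × (Y (S V i + V i) ≡ alt α β (suc i))
runs-split {α} {β} {U} {V} {X} {Y} i rX rY fd lt =
  agree , subst (λ z → X (z + V i) ≡ alt α β i) SUV (runs-letter rX i (V i) lt) , runs-next rY i
  where
  SUV : S U i ≡ S V i
  SUV = S-cong U V i fd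
  agree : Agree X Y (S V i + V i)
  agree q q< with blockOf V (runs-pos rY) q
  ... | j , bj with inBlock⇒offset V q j bj
  ... | t , refl , t< with <-cmp j i
  ... | tri> _ _ gt = ⊥-elim (<-irrefl refl (<-≤-trans q< (≤-trans (S-mono-≤ V (suc i) j gt) (proj₁ bj))))
  ... | tri≈ _ refl _ = trans (subst (λ z → X (z + t) ≡ alt α β j) SUV (runs-letter rX j t (<-trans t< lt)))
      (sym (runs-letter rY j t t<))
  ... | tri< j<i _ _ = trans (subst (λ z → X (z + t) ≡ alt α β j) (S-cong U V j (λ l l< → fd l (<-trans l< j<i)))
                                    (runs-letter rX j t (subst (t <_) (sym (fd j j<i)) t<)))
                             (sym (runs-letter rY j t t<))

runs-agree : ∀ {α β U V X Y} N → Runs α β U X → Runs α β V Y → (∀ i → i ≤ N → U i ≡ V i) → ∀ q → q ≤ suc N → X q ≡ Y q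
runs-agree {α} {β} {U} {V} {X} {Y} N rX rY ag q q≤ with blockOf U (runs-pos rX) q
... | j , bj with inBlock⇒offset U q j bj
... | t , refl , t< with m≤n⇒m<n∨m≡n (≤-trans (≤-trans (≤-S U (runs-pos rX) j) (m≤m+n (S U j) t)) q≤)
... | inj₁ (s≤s j≤N) = trans (runs-letter rX j t t<)
    (sym (subst (λ z → Y (z + t) ≡ alt α β j) (sym SUV) (runs-letter rY j t (subst (t <_) (ag j j≤N) t<))))
  where
  SUV : S U j ≡ S V j
  SUV = S-cong U V j (λ l l< → ag l (≤-trans (<⇒≤ l<) j≤N))
... | inj₂ refl = trans (runs-letter rX (suc N) t t<) (sym (trans (cong Y e) (runs-letter rY (suc N) 0 (runs-pos rY (suc N)))))
  where
  t≡0 : t ≡ 0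
  t≡0 = n≤0⇒n≡0 (+-cancelˡ-≤ (S U (suc N)) t 0
      (subst (S U (suc N) + t ≤_) (sym (+-identityʳ _)) (≤-trans q≤ (≤-S U (runs-pos rX) (suc N)))))
  e : S U (suc N) + t ≡ S V (suc N) + 0
  e = cong₂ _+_ (S-cong U V (suc N) (λ l l< → ag l (≤-pred l<))) t≡0

data Divergence (α β : ℕ) (U V X Y : Word) (n i : ℕ) : Set where
  left-longer : V i < U i → n ≡ S V i + V i → X n ≡ alt α β i → Y n ≡ alt α β (suc i) → Divergence α β U V X Y n i
  right-longer : U i < V i → n ≡ S U i + U i → X n ≡ alt α β (suc i) → Y n ≡ alt α β i → Divergence α β U V X Y n i

runs-divergence : ∀ {α β U V X Y} n → α ≢ β → Runs α β U X → Runs α β V Y → Agree X Y n → X n ≢ Y n →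
  ∃ λ i → Agree U V i × Divergence α β U V X Y n i
runs-divergence {α} {β} {U} {V} {X} {Y} n α≢β rX rY fd d with first-difference U V n
... | inj₁ ag = ⊥-elim (d (runs-agree n rX rY ag n (n≤1+n n)))
... | inj₂ (i , _ , fdi , nei) with <-cmp (U i) (V i)
... | tri≈ _ e _ = ⊥-elim (nei e)
... | tri> _ _ gt with runs-split i rX rY fdi gt
...   | agree , x≡ , y≡ = i , fdi , left-longer gt n≡ (subst (λ z → X z ≡ alt α β i) (sym n≡) x≡)
    (subst (λ z → Y z ≡ alt α β (suc i)) (sym n≡) y≡)
  where
  n≡ : n ≡ S V i + V i
  n≡ = first-difference-unique n (S V i + V i) fd d agree (λ e → alt-≢-suc α β α≢β i (trans (sym x≡) (trans e y≡)))
runs-divergence {α} {β} {U} {V} {X} {Y} n α≢β rX rY fd d | inj₂ (i , _ , fdi , nei) | tri< lt _ _ with runs-split i rY rX (Agree-sym i fdi) lt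
...   | agree , y≡ , x≡ = i , fdi , right-longer lt n≡ (subst (λ z → X z ≡ alt α β (suc i)) (sym n≡) x≡)
    (subst (λ z → Y z ≡ alt α β i) (sym n≡) y≡)
  where
  n≡ : n ≡ S U i + U i
  n≡ = first-difference-unique n (S U i + U i) fd d (Agree-sym _ agree)
      (λ e → alt-≢-suc α β α≢β i (trans (sym y≡) (trans (sym e) x≡)))

runs-suffix : ∀ {α β U X} → Runs α β U X → ∀ k t r → t + r ≡ U k → 1 ≤ r →
  Runs (alt α β k) (alt β α k) (r ∷w σ (suc k) U) (σ (S U k + t) X)
runs-suffix {α} {β} {U} {X} rX k t r eq r≥ = mkRuns pos letter
  where
  pos : Positive (r ∷w σ (suc k) U)
  pos zero = r≥
  pos (suc i) = runs-pos rX (suc k + i)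
  position : ∀ i j → S U k + t + (S (r ∷w σ (suc k) U) (suc i) + j) ≡ S U (suc k + i) + j
  position i j rewrite S-∷ r (σ (suc k) U) i | S-+ U (suc k) i | sym eq =
    solve 5 (λ s t r s' j → s :+ t :+ (r :+ s' :+ j) := s :+ (t :+ r) :+ s' :+ j) refl (S U k) t r (S (σ (suc k) U) i) j
  letter : ∀ i j → j < (r ∷w σ (suc k) U) i → σ (S U k + t) X (S (r ∷w σ (suc k) U) i + j) ≡ alt (alt α β k) (alt β α k) i
  letter zero j j< = trans (cong X (+-assoc (S U k) t j)) (runs-letter rX k (t + j) (subst (t + j <_) eq (+-monoʳ-< t j<)))
  letter (suc i) j j< = trans (cong X (position i j))
    (trans (runs-letter rX (suc k + i) j j<) (trans (cong (alt α β) (sym (+-suc k i))) (sym (alt-+ α β k (suc i)))))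

runs-drop : ∀ {α β U X} → Runs α β U X → ∀ k → Runs (alt α β k) (alt β α k) (σ k U) (σ (S U k) X)
runs-drop {U = U} {X} rX k = Runs-cong (runs-suffix rX k 0 (U k) refl (runs-pos rX k)) (∷-σ U k) (σ-+0 X (S U k))

module WithoutOne (a b : ℕ) (a-odd : even a ≡ false) (b-odd : even b ≡ false) (a<b : a < b) (a≢1 : a ≢ 1) where

  3≤a : 3 ≤ a
  3≤a = odd-≢1⇒≥3 a a-odd a≢1

  1+a<b : suc a < b
  1+a<b = ≤∧≢⇒< a<b (λ e → true≢false (trans (sym (cong not a-odd)) (trans (cong even e) b-odd)))

  a≢b : a ≢ b
  a≢b e = <-irrefl e a<b

  b≮a : ¬ (b < a)
  b≮a lt = <-asym lt a<b

  over-≥3 : ∀ {U} → OverAB a b U → ∀ k → 3 ≤ U k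
  over-≥3 ov k with ov k
  ... | inj₁ e = subst (3 ≤_) (sym e) 3≤a
  ... | inj₂ e = subst (3 ≤_) (sym e) (≤-trans 3≤a (<⇒≤ a<b))

  over-pos : ∀ {U} → OverAB a b U → Positive U
  over-pos ov k = ≤-trans (s≤s z≤n) (over-≥3 ov k)

  over-odd : ∀ {U} → OverAB a b U → OddRuns U
  over-odd ov k with ov k
  ... | inj₁ e = trans (cong even e) a-odd
  ... | inj₂ e = trans (cong even e) b-odd

  isDelta-head-a : ∀ {X U} → IsDelta a b X U → X 0 ≡ a → Runs a b U X
  isDelta-head-a {X} {U} (inj₁ d) _ = toRuns {a} {b} {U} {X} d
  isDelta-head-a {X} {U} (inj₂ d) e = ⊥-elim (a≢b (trans (sym e) (runs-head (toRuns {b} {a} {U} {X} d))))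

  isDelta-head-b : ∀ {X U} → IsDelta a b X U → X 0 ≡ b → Runs b a U X
  isDelta-head-b {X} {U} (inj₂ d) _ = toRuns {b} {a} {U} {X} d
  isDelta-head-b {X} {U} (inj₁ d) e = ⊥-elim (a≢b (trans (sym (runs-head (toRuns {a} {b} {U} {X} d))) e))

  -- The second run of u (a b-run) has length at least 3, so at an even block j the word x has an
  -- a-run of length b ≥ a + 2; the suffix one letter into it begins with a^(a+1), x with a^a b.
  ¬Lyndon-Δ-head-a : ∀ {x u v} → Runs a b u x → Runs a b v u → OverAB a b u → OverAB a b v → ¬ Lyndon x
  ¬Lyndon-Δ-head-a {x} {u} {v} rx ru ou ov ly = b≮a (subst₂ _<_ xa suffix-a
      (<lex-at a (ly n (subst (1 ≤_) (+-comm 1 (S u j)) (s≤s z≤n))) agree ne))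
    where
    j : ℕ
    j = v 0 + 1
    uj : u j ≡ b
    uj = runs-letter ru 1 1 (≤-trans (s≤s (s≤s z≤n)) (over-≥3 ov 1))
    n : ℕ
    n = S u j + 1
    suffix : ∀ i → i ≤ a → x (n + i) ≡ a
    suffix i i≤ = trans (cong x (+-assoc (S u j) 1 i))
      (trans (runs-letter rx j (1 + i) (subst (suc i <_) (sym uj) (≤-<-trans (s≤s i≤) 1+a<b)))
             (alt-even a b j (trans (even-+-odd (v 0) 1 refl) (cong not (over-odd ov 0)))))
    suffix-a : σ n x a ≡ a
    suffix-a = suffix a ≤-refl
    xa : x a ≡ b
    xa = trans (cong x (sym (trans (+-identityʳ (u 0)) (runs-head ru)))) (runs-letter rx 1 0 (over-pos ou 1))
    agree : Agree x (σ n x) a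
    agree i i< = trans (runs-letter rx 0 i (subst (i <_) (sym (runs-head ru)) i<)) (sym (suffix i (<⇒≤ i<)))
    ne : x a ≢ σ n x a
    ne eq = a≢b (trans (sym suffix-a) (trans (sym eq) xa))

  -- Here u = b^(v 0) a …, so x = a^b b^b …; the suffix of x at its block k = v 0 - 1, the last block
  -- of length b, reads a^b b^a a and is smaller than x at position b + a.
  ¬Lyndon-Δ-head-b : ∀ {x u v} → Runs a b u x → Runs b a v u → OverAB a b u → OverAB a b v → ¬ Lyndon x
  ¬Lyndon-Δ-head-b {x} {u} {v} rx ru ou ov ly = b≮a (subst₂ _<_ xba suffix-ba (<lex-at (b + a) (ly n n≥1) agree ne))
    where
    k : ℕ
    k = v 0 ∸ 1
    1+k : suc k ≡ v 0
    1+k = trans (+-comm 1 k) (m∸n+n≡m (over-pos ov 0))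
    k-even : even k ≡ true
    k-even = even-suc⁻¹ k (trans (cong even 1+k) (over-odd ov 0))
    u-prefix : ∀ i → i < v 0 → u i ≡ b
    u-prefix i i< = runs-letter ru 0 i i<
    uk : u k ≡ b
    uk = u-prefix k (subst (k <_) 1+k ≤-refl)
    u1+k : u (suc k) ≡ a
    u1+k = trans (cong u (trans 1+k (sym (+-identityʳ (v 0))))) (runs-letter ru 1 0 (over-pos ov 1))
    u1 : u 1 ≡ b
    u1 = u-prefix 1 (≤-trans (s≤s (s≤s z≤n)) (over-≥3 ov 0))
    n : ℕ
    n = S u k
    n≥1 : 1 ≤ n
    n≥1 = ≤-trans (≤-trans (s≤s z≤n) (≤-pred (subst (3 ≤_) (sym 1+k) (over-≥3 ov 0)))) (≤-S u (over-pos ou) k)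
    suffix-low : ∀ i → i < b → x (n + i) ≡ a
    suffix-low i i< = trans (runs-letter rx k i (subst (i <_) (sym uk) i<)) (alt-even a b k k-even)
    suffix-mid : ∀ t → t < a → x (n + (b + t)) ≡ b
    suffix-mid t t< = trans (cong x (trans (sym (+-assoc n b t)) (cong (λ z → n + z + t) (sym uk))))
      (trans (runs-letter rx (suc k) t (subst (t <_) (sym u1+k) t<)) (alt-odd a b (suc k) (even-suc k k-even)))
    suffix-ba : x (n + (b + a)) ≡ a
    suffix-ba = trans (cong x position) (trans (runs-letter rx (suc (suc k)) 0 (over-pos ou (suc (suc k))))
        (alt-even a b k k-even))
      where
      position : n + (b + a) ≡ S u (suc (suc k)) + 0
      position = trans (sym (+-assoc n b a)) (trans (cong₂ (λ p q → n + p + q) (sym uk) (sym u1+k)) (sym (+-identityʳ _)))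
    x-low : ∀ i → i < b → x i ≡ a
    x-low i i< = runs-letter rx 0 i (subst (i <_) (sym (runs-head ru)) i<)
    x-high : ∀ t → t < b → x (b + t) ≡ b
    x-high t t< = trans (cong (λ z → x (z + t)) (sym (runs-head ru))) (runs-letter rx 1 t (subst (t <_) (sym u1) t<))
    xba : x (b + a) ≡ b
    xba = x-high a a<b
    agree : Agree x (σ n x) (b + a)
    agree i i< with i <? b
    ... | yes lt = trans (x-low i lt) (sym (suffix-low i lt))
    ... | no nl = trans (cong x (sym ei))
        (trans (x-high t (<-trans t<a a<b)) (sym (trans (cong (λ z → x (n + z)) (sym ei)) (suffix-mid t t<a))))
      where
      t : ℕ
      t = i ∸ b
      ei : b + t ≡ i
      ei = m+[n∸m]≡n (≮⇒≥ nl)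
      t<a : t < a
      t<a = +-cancelˡ-< b t a (subst (_< b + a) (sym ei) i<)
    ne : x (b + a) ≢ σ n x (b + a)
    ne eq = a≢b (trans (sym suffix-ba) (trans (sym eq) xba))

  ¬smooth-Lyndon : ∀ {w} → Smooth a b w → Lyndon w → ⊥
  ¬smooth-Lyndon (W , W0≈w , over , isDelta) lyw = by-Δ-head (over 1 0)
    where
    ly : Lyndon (W 0)
    ly = Lyndon-cong (λ i → sym (W0≈w i)) lyw
    rx : Runs a b (W 1) (W 0)
    rx = isDelta-head-a (isDelta 0) (Lyndon-head a<b (over 0) ly)
    by-Δ-head : (W 1 0 ≡ a) ⊎ (W 1 0 ≡ b) → ⊥
    by-Δ-head (inj₁ u0) = ¬Lyndon-Δ-head-a rx (isDelta-head-a (isDelta 1) u0) (over 1) (over 2) ly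
    by-Δ-head (inj₂ u0) = ¬Lyndon-Δ-head-b rx (isDelta-head-b (isDelta 1) u0) (over 1) (over 2) ly

-- The order that Δ⁻¹₁ transports to lexicographic order on words over {1 < b}: at an even block a
-- longer run of 1s makes the word smaller, at an odd block a longer run of bs makes it larger.
data AltBefore (n p q : ℕ) : Set where
  at-even : even n ≡ true → q < p → AltBefore n p q
  at-odd : even n ≡ false → p < q → AltBefore n p q

_<alt_ : Word → Word → Set
x <alt y = ∃ λ n → Agree x y n × AltBefore n (x n) (y n)

AltBefore⇒≢ : ∀ {n p q} → AltBefore n p q → p ≢ q
AltBefore⇒≢ (at-even _ lt) e = <-irrefl (sym e) lt
AltBefore⇒≢ (at-odd _ lt) e = <-irrefl e lt

<alt-at : ∀ {x y} d → x <alt y → Agree x y d → x d ≢ y d → AltBefore d (x d) (y d)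
<alt-at d (n , fd , ac) fd' ne with first-difference-unique n d fd (AltBefore⇒≢ ac) fd' ne
... | refl = ac

-- Along the Δ-tower of a smooth Lyndon word over {1 < b} whose Δ starts with b, the even levels are
-- Lyndon and (from level 2 on) TailLyndon, and the odd levels are AltLyndon.
AltLyndonAt : Word → ℕ → Set
AltLyndonAt u j = even j ≡ true → 2 ≤ j → u <alt σ j u

AltLyndon : Word → Set
AltLyndon u = ∀ j → AltLyndonAt u j

TailLyndonAt : Word → ℕ → Set
TailLyndonAt x n = even n ≡ false → 3 ≤ n → σ 1 x <lex σ n x

TailLyndon : Word → Set
TailLyndon x = ∀ n → TailLyndonAt x n

<alt-cong : ∀ {x x' y y'} → x ≈w x' → y ≈w y' → x <alt y → x' <alt y'
<alt-cong ex ey (n , fd , ac) = n , (λ i i< → trans (sym (ex i)) (trans (fd i i<) (ey i))) , subst₂ (AltBefore n) (ex n) (ey n) ac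

<lex-cong : ∀ {x x' y y' : Word} → x ≈w x' → y ≈w y' → x <lex y → x' <lex y'
<lex-cong ex ey (n , fd , lt) = n , (λ i i< → trans (sym (ex i)) (trans (fd i i<) (ey i))) , subst₂ _<_ (ex n) (ey n) lt

<alt-∷ : ∀ {c d x y} → (c ∷w x) <alt (c ∷w y) → (d ∷w x) <alt (d ∷w y)
<alt-∷ (zero , _ , ac) = ⊥-elim (AltBefore⇒≢ ac refl)
<alt-∷ {d = d} {x} {y} (suc n , fd , ac) = suc n , agree , ac
  where
  agree : Agree (d ∷w x) (d ∷w y) (suc n)
  agree zero _ = refl
  agree (suc i) i< = fd (suc i) i<

<lex-tail : ∀ {x y : Word} → x 0 ≡ y 0 → x <lex y → σ 1 x <lex σ 1 y
<lex-tail e0 (zero , _ , lt) = ⊥-elim (<-irrefl e0 lt)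
<lex-tail e0 (suc n , fd , lt) = n , (λ i i< → fd (suc i) (s≤s i<)) , lt

<lex-∷ : ∀ {x y : Word} {c} → x 0 ≡ c → σ 1 x <lex y → x <lex (c ∷w y)
<lex-∷ {x} {y} {c} e0 (n , fd , lt) = suc n , agree , lt
  where
  agree : Agree x (c ∷w y) (suc n)
  agree zero _ = e0
  agree (suc i) (s≤s i<) = fd i i<

<alt⇒head-≥ : ∀ {x y} → x <alt y → y 0 ≤ x 0
<alt⇒head-≥ (zero , _ , at-even _ lt) = <⇒≤ lt
<alt⇒head-≥ (suc n , fd , _) = ≤-reflexive (sym (fd 0 (s≤s z≤n)))

σ-head : ∀ (u : Word) k → σ k u 0 ≡ u k
σ-head u k = cong u (+-identityʳ k)

<alt⇒>lex : ∀ {x y : Word} → Positive x → (∀ i → even i ≡ false → y i ≡ 1) → x <alt y → y <lex x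
<alt⇒>lex px y-odd (i , fd , at-even _ lt) = i , Agree-sym i fd , lt
<alt⇒>lex px y-odd (i , fd , at-odd e lt) = ⊥-elim (<-irrefl refl (<-≤-trans (subst (_ <_) (y-odd i e) lt) (px i)))

>lex⇒<alt : ∀ {x y : Word} → Positive y → (∀ i → even i ≡ false → x i ≡ 1) → y <lex x → x <alt y
>lex⇒<alt {x} {y} py x-odd (i , fd , lt) with even i in e
... | true = i , Agree-sym i fd , at-even e lt
... | false = ⊥-elim (<-irrefl refl (<-≤-trans (subst (_ <_) (x-odd i e) lt) (py i)))

≈-∷σ : ∀ (u : Word) k {c} → u k ≡ c → σ k u ≈w (c ∷w σ (suc k) u)
≈-∷σ u k e i = trans (sym (∷-σ u k i)) (cong (λ z → (z ∷w σ (suc k) u) i) e)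

module WithOne (b : ℕ) (b-odd : even b ≡ false) (3≤b : 3 ≤ b) where
  1<b : 1 < b
  1<b = ≤-trans (s≤s (s≤s z≤n)) 3≤b

  b≢1 : b ≢ 1
  b≢1 e = <-irrefl (sym e) 1<b

  1≢b : 1 ≢ b
  1≢b e = b≢1 (sym e)

  b≮1 : ¬ (b < 1)
  b≮1 lt = <-asym lt 1<b

  over-pos : ∀ {U} → OverAB 1 b U → Positive U
  over-pos ov k with ov k
  ... | inj₁ e = subst (1 ≤_) (sym e) ≤-refl
  ... | inj₂ e = subst (1 ≤_) (sym e) (<⇒≤ 1<b)

  over-odd : ∀ {U} → OverAB 1 b U → OddRuns U
  over-odd ov k with ov k
  ... | inj₁ e rewrite e = refl
  ... | inj₂ e rewrite e = b-odd

  <lex-1b : ∀ {x y : Word} q → Agree x y q → x q ≡ 1 → y q ≡ b → x <lex y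
  <lex-1b q fd ex ey = q , fd , subst₂ _<_ (sym ex) (sym ey) 1<b

  AltBefore-even : ∀ {n p q} → even n ≡ true → q ≡ 1 → p ≡ b → AltBefore n p q
  AltBefore-even e eq ep = at-even e (subst₂ _<_ (sym eq) (sym ep) 1<b)

  AltBefore-odd : ∀ {n p q} → even n ≡ false → p ≡ 1 → q ≡ b → AltBefore n p q
  AltBefore-odd e ep eq = at-odd e (subst₂ _<_ (sym ep) (sym eq) 1<b)

  AltBefore-b1 : ∀ {n p q} → AltBefore n p q → p ≡ b → q ≡ 1 → even n ≡ true
  AltBefore-b1 (at-even e _) _ _ = e
  AltBefore-b1 (at-odd _ lt) refl refl = ⊥-elim (b≮1 lt)

  AltBefore-1b : ∀ {n p q} → AltBefore n p q → p ≡ 1 → q ≡ b → even n ≡ false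
  AltBefore-1b (at-odd e _) _ _ = e
  AltBefore-1b (at-even _ lt) refl refl = ⊥-elim (b≮1 lt)

  data AltLetters (i : ℕ) : Set where
    even-block : even i ≡ true → alt 1 b i ≡ 1 → alt 1 b (suc i) ≡ b → AltLetters i
    odd-block : even i ≡ false → alt 1 b i ≡ b → alt 1 b (suc i) ≡ 1 → AltLetters i

  altLetters : ∀ i → AltLetters i
  altLetters i with even i in e
  ... | true = even-block e (alt-even 1 b i e) (alt-odd 1 b (suc i) (cong not e))
  ... | false = odd-block e (alt-odd 1 b i e) (alt-even 1 b (suc i) (cong not e))

  runs-1b-<alt⇒<lex : ∀ {U V X Y} → Runs 1 b U X → Runs 1 b V Y → U <alt V → X <lex Y
  runs-1b-<alt⇒<lex rX rY (i , fd , at-even e lt) =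
    let (agree , x≡ , y≡) = runs-split i rX rY fd lt in
    <lex-1b _ agree (trans x≡ (alt-even 1 b i e)) (trans y≡ (alt-odd 1 b (suc i) (even-suc i e)))
  runs-1b-<alt⇒<lex rX rY (i , fd , at-odd e lt) =
    let (agree , y≡ , x≡) = runs-split i rY rX (Agree-sym i fd) lt in
    <lex-1b _ (Agree-sym _ agree) (trans x≡ (alt-even 1 b (suc i) (even-suc i e))) (trans y≡ (alt-odd 1 b i e))

  runs-1b-<lex⇒<alt : ∀ {U V X Y} → Runs 1 b U X → Runs 1 b V Y → X <lex Y → U <alt V
  runs-1b-<lex⇒<alt rX rY (n , fd , lt) with runs-divergence n 1≢b rX rY fd (<⇒≢ lt)
  ... | i , fdi , left-longer vu _ x≡ y≡ with altLetters i
  ...   | even-block e _ _ = i , fdi , at-even e vu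
  ...   | odd-block _ x' y' = ⊥-elim (b≮1 (subst₂ _<_ (trans x≡ x') (trans y≡ y') lt))
  runs-1b-<lex⇒<alt rX rY (n , fd , lt) | i , fdi , right-longer uv _ x≡ y≡ with altLetters i
  ...   | odd-block e _ _ = i , fdi , at-odd e uv
  ...   | even-block _ y' x' = ⊥-elim (b≮1 (subst₂ _<_ (trans x≡ x') (trans y≡ y') lt))

  even-blockEnd-over : ∀ {U n c} i → OddRuns U → n ≡ S U i + U i → even i ≡ c → even n ≡ not c
  even-blockEnd-over {U} i ou refl e = trans (even-blockEnd U i ou) (cong not e)

  runs-1b->lex⇒<alt : ∀ {U V X Y} → Runs 1 b U X → Runs 1 b V Y → OddRuns V → V <lex U → X <alt Y
  runs-1b->lex⇒<alt {V = V} rX rY ov (i , fd , lt) with runs-split i rX rY (Agree-sym i fd) lt | altLetters i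
  ... | agree , x≡ , y≡ | even-block e x' y' =
    S V i + V i , agree , AltBefore-odd (even-blockEnd-over i ov refl e) (trans x≡ x') (trans y≡ y')
  ... | agree , x≡ , y≡ | odd-block e x' y' =
    S V i + V i , agree , AltBefore-even (even-blockEnd-over i ov refl e) (trans y≡ y') (trans x≡ x')

  runs-1b-<alt⇒>lex : ∀ {U V X Y} → Runs 1 b U X → Runs 1 b V Y → OddRuns U → X <alt Y → V <lex U
  runs-1b-<alt⇒>lex rX rY ou (n , fd , ac) with runs-divergence n 1≢b rX rY fd (AltBefore⇒≢ ac)
  ... | i , fdi , left-longer vu _ _ _ = i , Agree-sym i fdi , vu
  ... | i , fdi , right-longer _ n≡ x≡ y≡ with altLetters i
  ...   | even-block e y' x' = ⊥-elim (true≢false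
      (trans (sym (AltBefore-b1 ac (trans x≡ x') (trans y≡ y'))) (even-blockEnd-over i ou n≡ e)))
  ...   | odd-block e y' x' = ⊥-elim (true≢false
      (trans (sym (even-blockEnd-over i ou n≡ e)) (AltBefore-1b ac (trans x≡ x') (trans y≡ y'))))

  runs-b1-<lex⇒<alt : ∀ {U V X Y} → Runs b 1 U X → Runs b 1 V Y → OddRuns U → U <lex V → X <alt Y
  runs-b1-<lex⇒<alt {U} rX rY ou (i , fd , lt) with runs-split i rY rX (Agree-sym i fd) lt | altLetters i
  ... | agree , y≡ , x≡ | even-block e x' y' =
    S U i + U i , Agree-sym _ agree , AltBefore-odd (even-blockEnd-over i ou refl e) (trans x≡ x') (trans y≡ y')
  ... | agree , y≡ , x≡ | odd-block e x' y' =
    S U i + U i , Agree-sym _ agree , AltBefore-even (even-blockEnd-over i ou refl e) (trans y≡ y') (trans x≡ x')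

  runs-b1-<alt⇒<lex : ∀ {U V X Y} → Runs b 1 U X → Runs b 1 V Y → OddRuns V → X <alt Y → U <lex V
  runs-b1-<alt⇒<lex rX rY ov (n , fd , ac) with runs-divergence n b≢1 rX rY fd (AltBefore⇒≢ ac)
  ... | i , fdi , right-longer uv _ _ _ = i , fdi , uv
  ... | i , fdi , left-longer _ n≡ x≡ y≡ with altLetters i
  ...   | even-block e y' x' = ⊥-elim (true≢false
      (trans (sym (AltBefore-b1 ac (trans x≡ x') (trans y≡ y'))) (even-blockEnd-over i ov n≡ e)))
  ...   | odd-block e y' x' = ⊥-elim (true≢false
      (trans (sym (even-blockEnd-over i ov n≡ e)) (AltBefore-1b ac (trans x≡ x') (trans y≡ y'))))

  Lyndon⇒AltLyndon : ∀ {u w} → Runs 1 b u w → OverAB 1 b u → Lyndon w → AltLyndon u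
  Lyndon⇒AltLyndon {u} rw ou ly j j-even 2≤j =
    runs-1b-<lex⇒<alt rw (Runs-letters (alt-even 1 b j j-even) (alt-even b 1 j j-even) (runs-drop rw j))
      (ly (S u j) (≤-trans (s≤s z≤n) (≤-trans 2≤j (≤-S u (over-pos ou) j))))

  -- A suffix of Δ⁻¹₁(u) starting inside an even block of length u k has runs r ∷ σ (suc k) u, r ≤ u k.
  AltLyndon⇒<alt-suffix : ∀ {u} → AltLyndon u → ∀ {k r} → even k ≡ true → (k ≡ 0 → r < u 0) → r ≤ u k →
    u <alt (r ∷w σ (suc k) u)
  AltLyndon⇒<alt-suffix {u} au {k} {r} k-even k≡0⇒r< r≤ with r <? u 0
  ... | yes r< = 0 , Agree-zero , at-even refl r<
  ... | no r≮ = <alt-cong (λ _ → refl) (≈-∷σ u k (sym r≡)) au-k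
    where
    au-k : u <alt σ k u
    au-k = au k k-even (even-≢0⇒≥2 k k-even (λ k≡0 → r≮ (k≡0⇒r< k≡0)))
    r≡ : r ≡ u k
    r≡ = ≤-antisym r≤ (≤-trans (subst (_≤ u 0) (σ-head u k) (<alt⇒head-≥ au-k)) (≮⇒≥ r≮))

  AltLyndon⇒Lyndon : ∀ {u w} → Runs 1 b u w → OverAB 1 b u → AltLyndon u → Lyndon w
  AltLyndon⇒Lyndon {u} {w} rw ou au n 1≤n with blockOf u (over-pos ou) n
  ... | k , bk with inBlock⇒offset u n k bk
  ... | t , refl , t< with remainder t<
  ... | r , t+r , 1≤r = by-parity (altLetters k)
    where
    rS : Runs (alt 1 b k) (alt b 1 k) (r ∷w σ (suc k) u) (σ (S u k + t) w)
    rS = runs-suffix rw k t r t+r 1≤r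
    by-parity : AltLetters k → w <lex σ (S u k + t) w
    by-parity (odd-block e _ _) = <lex-1b 0 Agree-zero (runs-head rw) (trans (runs-head rS) (alt-odd 1 b k e))
    by-parity (even-block e _ _) = runs-1b-<alt⇒<lex rw (Runs-letters (alt-even 1 b k e) (alt-even b 1 k e) rS)
      (AltLyndon⇒<alt-suffix au e (λ { refl → subst (r <_) t+r (m<n+m r 1≤n) }) (subst (r ≤_) t+r (m≤n+m r t)))

  over-∷ : ∀ {r v} m → r ≡ 1 ⊎ r ≡ b → OverAB 1 b v → OverAB 1 b (r ∷w σ m v)
  over-∷ m or ov zero = or
  over-∷ m or ov (suc i) = ov (m + i)

  b-1 : ℕ

  b-1 = b ∸ 1

  b-1+ : 1 + b-1 ≡ b
  b-1+ = trans (+-comm 1 b-1) (pred+1 b (<⇒≤ 1<b))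

  b-1≥1 : 1 ≤ b-1
  b-1≥1 = ≤-pred (subst (2 ≤_) (sym b-1+) 1<b)

  b-1-even : even b-1 ≡ true
  b-1-even = even-pred b b-odd

  b-1≥2 : 2 ≤ b-1
  b-1≥2 = ≤-pred (subst (3 ≤_) (sym b-1+) 3≤b)

  -- If v starts with b then u = Δ⁻¹_b(v) = b^b 1 …, and the suffix of u at b - 1 reads b 1 …
  AltLyndon⇒Δ-head≡1 : ∀ {v u} → Runs b 1 v u → OverAB 1 b v → AltLyndon u → v 0 ≡ 1
  AltLyndon⇒Δ-head≡1 {v} {u} ru ov au with ov 0
  ... | inj₁ v0≡1 = v0≡1
  ... | inj₂ v0≡b = ⊥-elim (true≢false (sym (AltBefore-b1 (<alt-at 1 (au b-1 b-1-even b-1≥2) agree ne) u1 u[b-1+1])))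
    where
    u-low : ∀ i → i < b → u i ≡ b
    u-low i i< = runs-letter ru 0 i (subst (i <_) (sym v0≡b) i<)
    u1 : u 1 ≡ b
    u1 = u-low 1 1<b
    u[b-1+1] : u (b-1 + 1) ≡ 1
    u[b-1+1] = trans (cong u (trans (pred+1 b (<⇒≤ 1<b)) (sym v0≡b))) (runs-next ru 0)
    agree : Agree u (σ b-1 u) 1
    agree zero _ = trans (u-low 0 (<-trans (s≤s z≤n) 1<b))
        (sym (u-low (b-1 + 0) (subst (_< b) (sym (+-identityʳ b-1)) (subst (b-1 <_) b-1+ ≤-refl))))
    agree (suc i) (s≤s ())
    ne : u 1 ≢ σ b-1 u 1
    ne eq = b≢1 (trans (sym u1) (trans eq u[b-1+1]))

  AltLyndon⇒TailLyndon-Δ : ∀ {v u} → Runs b 1 v u → OverAB 1 b v → AltLyndon u → v 0 ≡ 1 → TailLyndon v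
  AltLyndon⇒TailLyndon-Δ {v} {u} ru ov au v0≡1 (suc k) n-odd 3≤n =
    <lex-tail v0≡1 (runs-b1-<alt⇒<lex ru rV (over-odd (over-∷ (suc k) (inj₁ refl) ov)) (au j j-even 2≤j))
    where
    k-even : even k ≡ true
    k-even = even-suc⁻¹ k n-odd
    t : ℕ
    t = v k ∸ 1
    j : ℕ
    j = S v k + t
    j-even : even j ≡ true
    j-even = trans (even-+-even (S v k) t (even-pred (v k) (over-odd ov k))) (trans (even-S v k (over-odd ov)) k-even)
    2≤j : 2 ≤ j
    2≤j = ≤-trans (≤-pred 3≤n) (≤-trans (≤-S v (over-pos ov) k) (m≤m+n (S v k) t))
    rV : Runs b 1 (1 ∷w σ (suc k) v) (σ j u)
    rV = Runs-letters (alt-even b 1 k k-even) (alt-even 1 b k k-even) (runs-suffix ru k t 1 (pred+1 (v k) (over-pos ov k)) ≤-refl)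

  TailLyndon⇒AltLyndon-Δ : ∀ {p m} → Runs 1 b p m → OverAB 1 b p → TailLyndon m → p 0 ≡ b → AltLyndon p
  TailLyndon⇒AltLyndon-Δ {p} {m} rm op tm p0≡b j j-even 2≤j with op j
  ... | inj₁ pj≡1 = 0 , Agree-zero , AltBefore-even refl (trans (σ-head p j) pj≡1) p0≡b
  ... | inj₂ pj≡b = <alt-cong (λ i → sym (≈-∷σ p 0 p0≡b i)) (λ i → sym (≈-∷σ p j pj≡b i))
      (<alt-∷ (runs-1b-<lex⇒<alt rX rY (tm n n-odd 3≤n)))
    where
    n : ℕ
    n = S p j + 1
    n-odd : even n ≡ false
    n-odd = trans (even-+-odd (S p j) 1 refl) (cong not (trans (even-S p j (over-odd op)) j-even))
    3≤n : 3 ≤ n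
    3≤n = subst (3 ≤_) (+-comm 1 (S p j)) (s≤s (≤-trans 2≤j (≤-S p (over-pos op) j)))
    rX : Runs 1 b (b-1 ∷w σ 1 p) (σ 1 m)
    rX = runs-suffix rm 0 1 b-1 (trans b-1+ (sym p0≡b)) b-1≥1
    rY : Runs 1 b (b-1 ∷w σ (suc j) p) (σ n m)
    rY = Runs-letters (alt-even 1 b j j-even) (alt-even b 1 j j-even) (runs-suffix rm j 1 b-1 (trans b-1+ (sym pj≡b)) b-1≥1)

  AltLyndon⇒TailLyndonAt : ∀ {p m} → Runs 1 b p m → OverAB 1 b p → p 0 ≡ b → ∀ n →
    (∀ j → S p j < n → AltLyndonAt p j) → TailLyndonAt m n
  AltLyndon⇒TailLyndonAt {p} {m} rm op p0≡b n below n-odd 3≤n with blockOf p (over-pos op) n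
  ... | k , bk with inBlock⇒offset p n k bk
  ... | t , refl , t< with remainder t<
  ... | r , t+r , 1≤r = by-parity (altLetters k)
    where
    rX : Runs 1 b (b-1 ∷w σ 1 p) (σ 1 m)
    rX = runs-suffix rm 0 1 b-1 (trans b-1+ (sym p0≡b)) b-1≥1
    rS : Runs (alt 1 b k) (alt b 1 k) (r ∷w σ (suc k) p) (σ (S p k + t) m)
    rS = runs-suffix rm k t r t+r 1≤r
    by-parity : AltLetters k → σ 1 m <lex σ (S p k + t) m
    by-parity (odd-block e _ _) = <lex-1b 0 Agree-zero (runs-head rX) (trans (runs-head rS) (alt-odd 1 b k e))
    by-parity (even-block e _ _) = runs-1b-<alt⇒<lex rX (Runs-letters (alt-even 1 b k e) (alt-even b 1 k e) rS) heads
      where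
      1≤t : 1 ≤ t
      1≤t = odd⇒≥1 t (trans (sym (even-+-cancelˡ (S p k) t (trans (even-S p k (over-odd op)) e))) n-odd)
      pk≡b : p k ≡ b
      pk≡b with op k
      ... | inj₂ pk≡b = pk≡b
      ... | inj₁ pk≡1 = ⊥-elim (<-irrefl refl (<-≤-trans (subst (t <_) pk≡1 t<) 1≤t))
      r≤ : r ≤ b-1
      r≤ = +-cancelˡ-≤ 1 r b-1 (subst (1 + r ≤_) (trans (trans t+r pk≡b) (sym b-1+)) (+-monoˡ-≤ r 1≤t))
      heads : (b-1 ∷w σ 1 p) <alt (r ∷w σ (suc k) p)
      heads with r <? b-1
      ... | yes r< = 0 , Agree-zero , at-even refl r<
      ... | no r≮ = subst (λ z → (b-1 ∷w σ 1 p) <alt (z ∷w σ (suc k) p)) (sym r≡)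
                      (<alt-∷ (<alt-cong (≈-∷σ p 0 p0≡b) (≈-∷σ p k pk≡b) (below k (m<m+n (S p k) 1≤t) e (even-≢0⇒≥2 k e k≢0))))
        where
        r≡ : r ≡ b-1
        r≡ = ≤-antisym r≤ (≮⇒≥ r≮)
        t≡1 : t ≡ 1
        t≡1 = +-cancelʳ-≡ r t 1 (trans t+r (trans pk≡b (sym (trans (cong (1 +_) r≡) b-1+))))
        k≢0 : k ≢ 0
        k≢0 refl = <-irrefl refl (<-≤-trans (subst (_< 3) (sym t≡1) (s≤s (s≤s z≤n))) 3≤n)

  TailLyndon⇒AltLyndonAt : ∀ {m p} → Runs b 1 m p → OverAB 1 b m → m 0 ≡ 1 → ∀ j →
    (∀ n → n ≤ suc j → TailLyndonAt m n) → AltLyndonAt p j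
  TailLyndon⇒AltLyndonAt {m} {p} rp om m0≡1 j below j-even 2≤j with blockOf m (over-pos om) j
  ... | k , bk with inBlock⇒offset m j k bk
  ... | t , refl , t< with remainder t<
  ... | r , t+r , 1≤r = by-parity (altLetters k)
    where
    rS : Runs (alt b 1 k) (alt 1 b k) (r ∷w σ (suc k) m) (σ (S m k + t) p)
    rS = runs-suffix rp k t r t+r 1≤r
    by-parity : AltLetters k → p <alt σ (S m k + t) p
    by-parity (odd-block e _ _) = 0 , Agree-zero , AltBefore-even refl (trans (runs-head rS) (alt-odd b 1 k e)) (runs-head rp)
    by-parity (even-block e _ _) = runs-b1-<lex⇒<alt rp (Runs-letters (alt-even b 1 k e) (alt-even 1 b k e) rS) (over-odd om)
        heads
      where
      heads : m <lex (r ∷w σ (suc k) m)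
      heads with r ≟ 1
      ... | no r≢1 = 0 , Agree-zero , subst (_< r) (sym m0≡1) (≤∧≢⇒< 1≤r (λ e → r≢1 (sym e)))
      ... | yes r≡1 = subst (λ z → m <lex (z ∷w σ (suc k) m)) (sym r≡1)
                        (<lex-∷ m0≡1 (below (suc k) (s≤s (≤-trans (≤-S m (over-pos om) k) (m≤m+n (S m k) t))) (even-suc k e) (s≤s (even-≢0⇒≥2 k e k≢0))))
        where
        k≢0 : k ≢ 0
        k≢0 refl = <-irrefl refl (<-≤-trans (subst (_< 2) (sym t≡0) (s≤s z≤n)) 2≤j)
          where
          t≡0 : t ≡ 0
          t≡0 = +-cancelʳ-≡ r t 0 (trans t+r (trans m0≡1 (sym r≡1)))

  AltLyndon⇒even-letter≢b : ∀ {u} → AltLyndon u → u 0 ≡ 1 → ∀ j → even j ≡ true → 2 ≤ j → u j ≢ b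
  AltLyndon⇒even-letter≢b {u} au u0≡1 j j-even 2≤j uj≡b =
    <⇒≱ 1<b (subst₂ _≤_ (trans (σ-head u j) uj≡b) u0≡1 (<alt⇒head-≥ (au j j-even 2≤j)))

  AltLyndon⇒odd-runs≡1 : ∀ {v u} → Runs 1 b v u → OverAB 1 b v → AltLyndon u → ∀ k → even k ≡ false → v k ≡ 1
  AltLyndon⇒odd-runs≡1 {v} {u} ru ov au k k-odd with ov k
  ... | inj₁ vk≡1 = vk≡1
  ... | inj₂ vk≡b = ⊥-elim (AltLyndon⇒even-letter≢b au (runs-head ru) j j-even 2≤j uj≡b)
    where
    j : ℕ
    j = S v k + 1
    j-even : even j ≡ true
    j-even = trans (even-+-odd (S v k) 1 refl) (cong not (trans (even-S v k (over-odd ov)) k-odd))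
    2≤j : 2 ≤ j
    2≤j = subst (2 ≤_) (+-comm 1 (S v k)) (s≤s (≤-trans (odd⇒≥1 k k-odd) (≤-S v (over-pos ov) k)))
    uj≡b : u j ≡ b
    uj≡b = trans (runs-letter ru k 1 (subst (1 <_) (sym vk≡b) 1<b)) (alt-odd 1 b k k-odd)

  AltLyndon-Δ : ∀ {v u} → Runs 1 b v u → OverAB 1 b v → AltLyndon u → AltLyndon v
  AltLyndon-Δ {v} {u} ru ov au k k-even 2≤k =
    >lex⇒<alt (λ i → over-pos ov (k + i)) (AltLyndon⇒odd-runs≡1 ru ov au) (runs-1b-<alt⇒>lex ru rK (over-odd ov) (au (S v k) Sk-even 2≤Sk))
    where
    rK : Runs 1 b (σ k v) (σ (S v k) u)
    rK = Runs-letters (alt-even 1 b k k-even) (alt-even b 1 k k-even) (runs-drop ru k)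
    Sk-even : even (S v k) ≡ true
    Sk-even = trans (even-S v k (over-odd ov)) k-even
    2≤Sk : 2 ≤ S v k
    2≤Sk = ≤-trans 2≤k (≤-S v (over-pos ov) k)

  AltLyndon-Δ⁻¹ : ∀ {v u} → Runs 1 b v u → OverAB 1 b v → v 0 ≡ b → (∀ k → even k ≡ false → v k ≡ 1) → AltLyndon v → AltLyndon u
  AltLyndon-Δ⁻¹ {v} {u} ru ov v0≡b v-odd av j j-even 2≤j with blockOf v (over-pos ov) j
  ... | k , bk with inBlock⇒offset v j k bk
  ... | t , refl , t< with remainder t<
  ... | r , t+r , 1≤r = by-parity (altLetters k)
    where
    rS : Runs (alt 1 b k) (alt b 1 k) (r ∷w σ (suc k) v) (σ (S v k + t) u)
    rS = runs-suffix ru k t r t+r 1≤r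
    even-Sk : ∀ {c} → even k ≡ c → even (S v k) ≡ c
    even-Sk e = trans (even-S v k (over-odd ov)) e
    by-parity : AltLetters k → u <alt σ (S v k + t) u
    by-parity (odd-block e _ _) = ⊥-elim (true≢false (trans (sym j-even) (trans (cong even j≡) (even-Sk e))))
      where
      j≡ : S v k + t ≡ S v k
      j≡ = trans (cong (S v k +_) (n<1⇒n≡0 (subst (t <_) (v-odd k e) t<))) (+-identityʳ _)
    by-parity (even-block e _ _) = runs-1b->lex⇒<alt ru (Runs-letters (alt-even 1 b k e) (alt-even b 1 k e) rS)
        (∷-odd v (suc k) r-odd (over-odd ov)) heads
      where
      t-even : even t ≡ true
      t-even = trans (sym (even-+-cancelˡ (S v k) t (even-Sk e))) j-even
      r-odd : even r ≡ false
      r-odd = trans (sym (even-+-cancelˡ t r t-even)) (trans (cong even t+r) (over-odd ov k))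
      vk≤b : v k ≤ b
      vk≤b with ov k
      ... | inj₁ vk≡1 = subst (_≤ b) (sym vk≡1) (<⇒≤ 1<b)
      ... | inj₂ vk≡b = ≤-reflexive vk≡b
      heads : (r ∷w σ (suc k) v) <lex v
      heads with r <? v 0
      ... | yes r< = 0 , Agree-zero , r<
      ... | no r≮ = <lex-cong (≈-∷σ v k (sym r≡)) (λ _ → refl) (<alt⇒>lex (over-pos ov) shifted-odd (av k e (even-≢0⇒≥2 k e k≢0)))
        where
        r≡ : r ≡ v k
        r≡ = ≤-antisym (subst (r ≤_) t+r (m≤n+m r t)) (≤-trans vk≤b (subst (_≤ r) v0≡b (≮⇒≥ r≮)))
        k≢0 : k ≢ 0
        k≢0 refl = <-irrefl refl (<-≤-trans (subst (_< 2) (sym t≡0) (s≤s z≤n)) 2≤j)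
          where
          t≡0 : t ≡ 0
          t≡0 = +-cancelʳ-≡ r t 0 (trans t+r (sym r≡))
        shifted-odd : ∀ i → even i ≡ false → σ k v i ≡ 1
        shifted-odd i i-odd = v-odd (k + i) (trans (even-+-cancelˡ k i e) i-odd)

  <S : ∀ {P} → P 0 ≡ b → Positive P → ∀ j → 1 ≤ j → j < S P j
  <S {P} p0 pos (suc zero) _ = subst (1 <_) (sym p0) 1<b
  <S {P} p0 pos (suc (suc i)) _ = <-≤-trans (s≤s (<S p0 pos (suc i) (s≤s z≤n)))
    (subst (suc (S P (suc i)) ≤_) (+-comm (P (suc i)) (S P (suc i))) (+-monoˡ-≤ (S P (suc i)) (pos (suc i))))

  module FixedPoint {M P : Word} (rM : Runs 1 b P M) (rP : Runs b 1 M P) (oM : OverAB 1 b M) (oP : OverAB 1 b P) where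

    -- Course-of-values induction: TailLyndonAt M n needs AltLyndonAt P only at j with S P j < n,
    -- and AltLyndonAt P j needs TailLyndonAt M only at n ≤ j + 1.
    AltLyndon-P : AltLyndon P
    AltLyndon-P = <-rec (AltLyndonAt P) step
      where
      step : ∀ j → (∀ {j'} → j' < j → AltLyndonAt P j') → AltLyndonAt P j
      step j ih = TailLyndon⇒AltLyndonAt rP oM (runs-head rM) j
        (λ n n≤ → AltLyndon⇒TailLyndonAt rM oP (runs-head rP) n (earlier n n≤))
        where
        earlier : ∀ n → n ≤ suc j → ∀ j' → S P j' < n → AltLyndonAt P j'
        earlier n n≤ zero _ _ ()
        earlier n n≤ (suc j') S< = ih (<-≤-trans (<S (runs-head rP) (over-pos oP) (suc j') (s≤s z≤n)) (≤-pred (<-≤-trans S< n≤)))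

    Lyndon-M : Lyndon M
    Lyndon-M = AltLyndon⇒Lyndon rM oP AltLyndon-P

    OnesAt : ℕ → Set
    OnesAt n = (even n ≡ true → M n ≡ 1) × (even n ≡ false → P n ≡ 1)

    ones : ∀ n → OnesAt n
    ones = <-rec OnesAt (λ n ih → M-even n ih , P-odd n ih)
      where
      M-even : ∀ n → (∀ {k} → k < n → OnesAt k) → even n ≡ true → M n ≡ 1
      M-even n ih n-even with blockOf P (over-pos oP) n
      ... | k , bk with altLetters k
      ... | even-block _ x≡1 _ = trans (runs-letter-inBlock rM n k bk) x≡1
      ... | odd-block k-odd _ _ = ⊥-elim (true≢false
          (trans (sym n-even) (trans (cong even n≡) (trans (even-S P k (over-odd oP)) k-odd))))
        where
        k<n : k < n
        k<n = <-≤-trans (<S (runs-head rP) (over-pos oP) k (odd⇒≥1 k k-odd)) (proj₁ bk)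
        n≡ : n ≡ S P k
        n≡ = inBlock-unit {P} bk (proj₂ (ih k<n) k-odd)
      P-odd : ∀ n → (∀ {k} → k < n → OnesAt k) → even n ≡ false → P n ≡ 1
      P-odd n ih n-odd with blockOf M (over-pos oM) n
      ... | k , bk with altLetters k
      ... | odd-block k-odd _ _ = trans (runs-letter-inBlock rP n k bk) (alt-odd b 1 k k-odd)
      ... | even-block k-even _ _ = ⊥-elim (true≢false
          (trans (sym k-even) (trans (sym (even-S M k (over-odd oM))) (trans (cong even (sym n≡)) n-odd))))
        where
        k<n : k < n
        k<n = ≤∧≢⇒< (≤-trans (≤-S M (over-pos oM) k) (proj₁ bk))
            (λ e → true≢false (trans (sym k-even) (trans (cong even e) n-odd)))
        n≡ : n ≡ S M k
        n≡ = inBlock-unit {M} bk (proj₁ (ih k<n) k-even)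

    odd-P≡1 : ∀ k → even k ≡ false → P k ≡ 1
    odd-P≡1 k = proj₂ (ones k)

  IsΔ1b : Word → Word → Set
  IsΔ1b X U = Runs 1 b U X ⊎ Runs b 1 U X

  isΔ-head-1 : ∀ {X U} → IsΔ1b X U → X 0 ≡ 1 → Runs 1 b U X
  isΔ-head-1 (inj₁ r) _ = r
  isΔ-head-1 (inj₂ r) e = ⊥-elim (b≢1 (trans (sym (runs-head r)) e))

  isΔ-head-b : ∀ {X U} → IsΔ1b X U → X 0 ≡ b → Runs b 1 U X
  isΔ-head-b (inj₂ r) _ = r
  isΔ-head-b (inj₁ r) e = ⊥-elim (1≢b (trans (sym (runs-head r)) e))

  -- If v 1 = b then u 2 = b; otherwise y starts with b, so v = 1^b b … and u (b + 1) = b.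
  AltLyndon⇒Δ²-head≢1 : ∀ {v u y} → Runs 1 b v u → OverAB 1 b v → AltLyndon u → IsΔ1b v y → OverAB 1 b y → v 0 ≢ 1
  AltLyndon⇒Δ²-head≢1 {v} {u} {y} ru ov au dy oy v0≡1 = by-v1 (ov 1)
    where
    ry : Runs 1 b y v
    ry = isΔ-head-1 dy v0≡1
    by-v1 : (v 1 ≡ 1) ⊎ (v 1 ≡ b) → ⊥
    by-v1 (inj₂ v1≡b) = AltLyndon⇒even-letter≢b au (runs-head ru) 2 refl ≤-refl
      (trans (cong (λ z → u (z + 1)) (sym v0≡1)) (runs-letter ru 1 1 (subst (1 <_) (sym v1≡b) 1<b)))
    by-v1 (inj₁ v1≡1) with oy 0
    ... | inj₁ y0≡1 = 1≢b (trans (sym v1≡1) (trans (cong (λ z → v (z + 0)) (sym y0≡1)) (runs-letter ry 1 0 (over-pos oy 1))))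
    ... | inj₂ y0≡b = AltLyndon⇒even-letter≢b au (runs-head ru) (b + 1) (trans (even-+-odd b 1 refl) (cong not b-odd))
        (≤-trans 1<b (m≤m+n b 1)) u[b+1]
      where
      v-low : ∀ l → l < b → v l ≡ 1
      v-low l l< = runs-letter ry 0 l (subst (l <_) (sym y0≡b) l<)
      vb : v b ≡ b
      vb = trans (cong v (sym (trans (+-identityʳ (y 0)) y0≡b))) (runs-letter ry 1 0 (over-pos oy 1))
      u[b+1] : u (b + 1) ≡ b
      u[b+1] = trans (cong (λ z → u (z + 1)) (sym (S-ones v b v-low)))
          (trans (runs-letter ru b 1 (subst (1 <_) (sym vb) 1<b)) (alt-odd 1 b b b-odd))

  -- m = 1 b^b 1 …, so σ b m = b 1 … is smaller than σ 1 m = b b ….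
  TailLyndon⇒Δ²-head≢1 : ∀ {m u v} → TailLyndon m → Runs 1 b u m → OverAB 1 b u → Runs 1 b v u → OverAB 1 b v → v 0 ≢ 1
  TailLyndon⇒Δ²-head≢1 {m} {u} {v} tm rm ou ru ov v0≡1 = b≮1 (subst₂ _<_ m2 m[b+1] (<lex-at 1 (tm b b-odd 3≤b) agree ne))
    where
    u1 : u 1 ≡ b
    u1 = trans (cong (λ z → u (z + 0)) (sym v0≡1)) (runs-letter ru 1 0 (over-pos ov 1))
    m-run : ∀ t → t < b → m (1 + t) ≡ b
    m-run t t< = trans (cong (λ z → m (z + t)) (sym (runs-head ru))) (runs-letter rm 1 t (subst (t <_) (sym u1) t<))
    m2 : m (1 + 1) ≡ b
    m2 = m-run 1 1<b
    m[b+1] : m (b + 1) ≡ 1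
    m[b+1] = trans (cong m (trans (+-comm b 1) (sym (trans (+-identityʳ _) (cong₂ _+_ (runs-head ru) u1)))))
        (runs-letter rm 2 0 (over-pos ou 2))
    agree : Agree (σ 1 m) (σ b m) 1
    agree zero _ = trans (m-run 0 (<-trans (s≤s z≤n) 1<b))
        (sym (trans (cong m (trans (+-identityʳ b) (sym b-1+))) (m-run b-1 (subst (b-1 <_) b-1+ ≤-refl))))
    agree (suc _) (s≤s ())
    ne : σ 1 m 1 ≢ σ b m 1
    ne eq = b≢1 (trans (sym m2) (trans eq m[b+1]))

  alt-+-even : ∀ K l → even K ≡ true → alt 1 b (K + l) ≡ alt 1 b l
  alt-+-even K l K-even rewrite alt-by-parity 1 b (K + l) | alt-by-parity 1 b l | +-comm K l | even-+-even l K K-even = refl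

  -- v = b^(y 0) 1^(y 1) b^(y 2) …, so with J = S y 2 and K = S v J, the block K of u is a 1-run of
  -- length b preceded by a b-run ending at k = K - 1; n is the last letter of the block k of m.
  alternating-suffix : ∀ {m u v y} → Runs 1 b u m → OverAB 1 b u → Runs 1 b v u → OverAB 1 b v → Runs b 1 y v → OverAB 1 b y →
    ∃ λ n → even n ≡ false × 3 ≤ n × m n ≡ b × (∀ l → l < b → m (n + suc l) ≡ alt 1 b l)
  alternating-suffix {m} {u} {v} {y} rm ou ru ov ry oy = n , n-odd , 3≤n , mn , m[n+1+l]
    where
    J₂ : ℕ
    J₂ = S y 2
    J₂-even : even J₂ ≡ true
    J₂-even = even-S y 2 (over-odd oy)
    vJ₂ : v J₂ ≡ b
    vJ₂ = trans (cong v (sym (+-identityʳ J₂))) (runs-letter ry 2 0 (over-pos oy 2))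
    J₁ : ℕ
    J₁ = J₂ ∸ 1
    1+J₁ : suc J₁ ≡ J₂
    1+J₁ = trans (+-comm 1 J₁) (pred+1 J₂ (≤-trans (s≤s z≤n) (≤-S y (over-pos oy) 2)))
    J₁-odd : even J₁ ≡ false
    J₁-odd = odd-suc⁻¹ J₁ (trans (cong even 1+J₁) J₂-even)
    k : ℕ
    k = S v J₁ + (v J₁ ∸ 1)
    K : ℕ
    K = S v J₂
    1+k : suc k ≡ K
    1+k = trans (sym (+-suc (S v J₁) (v J₁ ∸ 1)))
        (trans (cong (S v J₁ +_) (trans (+-comm 1 _) (pred+1 (v J₁) (over-pos ov J₁)))) (cong (S v) 1+J₁))
    K-even : even K ≡ true
    K-even = trans (even-S v J₂ (over-odd ov)) J₂-even
    k-odd : even k ≡ false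
    k-odd = odd-suc⁻¹ k (trans (cong even 1+k) K-even)
    uk : u k ≡ b
    uk = trans (runs-letter ru J₁ (v J₁ ∸ 1) (subst (v J₁ ∸ 1 <_) (pred+1 (v J₁) (over-pos ov J₁)) (m<m+n (v J₁ ∸ 1) (s≤s z≤n))))
        (alt-odd 1 b J₁ J₁-odd)
    u[K+l] : ∀ l → l < b → u (K + l) ≡ 1
    u[K+l] l l< = trans (runs-letter ru J₂ l (subst (l <_) (sym vJ₂) l<)) (alt-even 1 b J₂ J₂-even)
    n : ℕ
    n = S u k + b-1
    n-odd : even n ≡ false
    n-odd = trans (even-+-even (S u k) b-1 b-1-even) (trans (even-S u k (over-odd ou)) k-odd)
    3≤n : 3 ≤ n
    3≤n = ≤-trans (s≤s b-1≥2) (+-monoˡ-≤ b-1 (≤-trans 1≤k (≤-S u (over-pos ou) k)))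
      where
      1≤k : 1 ≤ k
      1≤k = ≤-trans (odd⇒≥1 J₁ J₁-odd) (≤-trans (≤-S v (over-pos ov) J₁) (m≤m+n (S v J₁) _))
    mn : m n ≡ b
    mn = trans (runs-letter rm k b-1 (subst (b-1 <_) (sym (trans uk (sym b-1+))) ≤-refl)) (alt-odd 1 b k k-odd)
    m[n+1+l] : ∀ l → l < b → m (n + suc l) ≡ alt 1 b l
    m[n+1+l] l l< = trans (cong m position) (trans (runs-letter rm (K + l) 0 (over-pos ou (K + l))) (alt-+-even K l K-even))
      where
      position : n + suc l ≡ S u (K + l) + 0
      position = begin
        S u k + b-1 + suc l   ≡⟨ +-assoc (S u k) b-1 (suc l) ⟩
        S u k + (b-1 + suc l) ≡⟨ cong (S u k +_) (trans (+-suc b-1 l) (cong (_+ l) b-1+)) ⟩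
        S u k + (b + l)       ≡⟨ sym (+-assoc (S u k) b l) ⟩
        S u k + b + l         ≡⟨ cong (λ z → S u k + z + l) (sym uk) ⟩
        S u (suc k) + l       ≡⟨ cong (λ z → S u z + l) 1+k ⟩
        S u K + l             ≡⟨ sym (S-+-ones u K l (λ l' l'< → u[K+l] l' (<-trans l'< l<))) ⟩
        S u (K + l)           ≡⟨ sym (+-identityʳ _) ⟩
        S u (K + l) + 0       ∎
        where open ≡-Reasoning

  -- If v 0 = b then u = 1^b b …, so m = (1 b)^((b+1)/2) b …, and the suffix of alternating-suffix
  -- reads b (1 b)^((b-1)/2) 1 …: it is smaller at position b.
  TailLyndon⇒Δ²-head≢b : ∀ {m u v y} → TailLyndon m → Runs 1 b u m → OverAB 1 b u → Runs 1 b v u → OverAB 1 b v →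
    Runs b 1 y v → OverAB 1 b y → v 0 ≢ b
  TailLyndon⇒Δ²-head≢b {m} {u} {v} tm rm ou ru ov ry oy v0≡b with alternating-suffix rm ou ru ov ry oy
  ... | n , n-odd , 3≤n , mn , m[n+1+l] = b≮1 (subst₂ _<_ m[1+b] σn[b] (<lex-at b (tm n n-odd 3≤n) agree ne))
    where
    S-low : ∀ l → l ≤ b → S u l ≡ l
    S-low l l≤ = S-ones u l (λ l' l'< → runs-letter ru 0 l' (subst (l' <_) (sym v0≡b) (<-≤-trans l'< l≤)))
    ub : u b ≡ b
    ub = trans (cong u (sym (trans (+-identityʳ (v 0)) v0≡b))) (runs-letter ru 1 0 (over-pos ov 1))
    m-prefix : ∀ p → p ≤ b → m p ≡ alt 1 b p
    m-prefix p p≤ = trans (cong m (sym (trans (+-identityʳ _) (S-low p p≤)))) (runs-letter rm p 0 (over-pos ou p))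
    m[1+b] : m (suc b) ≡ b
    m[1+b] = trans (cong m (trans (+-comm 1 b) (cong (_+ 1) (sym (S-low b ≤-refl)))))
        (trans (runs-letter rm b 1 (subst (1 <_) (sym ub) 1<b)) (alt-odd 1 b b b-odd))
    agree : Agree (σ 1 m) (σ n m) b
    agree zero _ = trans (m-prefix 1 (<⇒≤ 1<b)) (sym (trans (cong m (+-identityʳ n)) mn))
    agree (suc l) l< = trans (m-prefix (suc (suc l)) l<) (sym (m[n+1+l] l (<-trans (n<1+n l) l<)))
    σn[b] : σ n m b ≡ 1
    σn[b] = trans (cong (λ z → m (n + z)) (sym b-1+))
        (trans (m[n+1+l] b-1 (subst (b-1 <_) b-1+ ≤-refl)) (alt-even 1 b b-1 b-1-even))
    ne : σ 1 m b ≢ σ n m b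
    ne eq = b≢1 (trans (sym m[1+b]) (trans eq σn[b]))

  TailLyndon⇒Δ-head≡b : ∀ {m u v y} → TailLyndon m → Runs 1 b u m → OverAB 1 b u → IsΔ1b u v → OverAB 1 b v →
    IsΔ1b v y → OverAB 1 b y → u 0 ≡ b
  TailLyndon⇒Δ-head≡b tm rm ou du ov dy oy with ou 0
  ... | inj₂ u0≡b = u0≡b
  ... | inj₁ u0≡1 with ov 0
  ...   | inj₁ v0≡1 = ⊥-elim (TailLyndon⇒Δ²-head≢1 tm rm ou (isΔ-head-1 du u0≡1) ov v0≡1)
  ...   | inj₂ v0≡b = ⊥-elim (TailLyndon⇒Δ²-head≢b tm rm ou (isΔ-head-1 du u0≡1) ov (isΔ-head-b dy v0≡b) oy v0≡b)

  blockSearch : (ℕ → ℕ) → ℕ → ℕ → ℕ → ℕ → ℕ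
  blockSearch-step : (ℕ → ℕ) → (i : ℕ) → ℕ → (a : ℕ) → ℕ → Dec (i < a) → ℕ
  blockSearch f i j acc zero = j
  blockSearch f i j acc (suc fuel) = blockSearch-step f i j (acc + f j) fuel (i <? acc + f j)
  blockSearch-step f i j a fuel (yes _) = j
  blockSearch-step f i j a fuel (no _) = blockSearch f i (suc j) a fuel

  -- A bounded search needing no positivity proof, so that approx below can be defined with it.
  blockIndex : (ℕ → ℕ) → ℕ → ℕ
  blockIndex f i = blockSearch f i 0 0 i

  blockSearch-inBlock : ∀ f i → Positive f → ∀ fuel j → fuel + j ≡ i → S f j ≤ i → InBlock f i (blockSearch f i j (S f j) fuel)
  blockSearch-inBlock f i pf zero j refl le = le , ≤-<-trans (≤-S f pf j) (m<m+n (S f j) (pf j))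
  blockSearch-inBlock f i pf (suc fuel) j eq le = by-test (i <? S f j + f j)
    where
    by-test : (d : Dec (i < S f j + f j)) → InBlock f i (blockSearch-step f i j (S f j + f j) fuel d)
    by-test (yes lt) = le , lt
    by-test (no nl) = blockSearch-inBlock f i pf fuel (suc j) (trans (+-suc fuel j) eq) (≮⇒≥ nl)

  blockIndex-inBlock : ∀ f → Positive f → ∀ i → InBlock f i (blockIndex f i)
  blockIndex-inBlock f pf i = blockSearch-inBlock f i pf i 0 (+-identityʳ i) z≤n

  blockSearch-cong : ∀ f g i → (∀ l → l < i → f l ≡ g l) → ∀ fuel j acc → fuel + j ≡ i → blockSearch f i j acc fuel ≡ blockSearch
      g i j acc fuel
  blockSearch-cong f g i h zero j acc eq = refl
  blockSearch-cong f g i h (suc fuel) j acc eq = trans (cong (λ x → blockSearch-step f i j (acc + x) fuel (i <? acc + x))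
      (h j j<i)) (by-test (i <? acc + g j))
    where
    j<i : j < i
    j<i = subst (j <_) eq (s≤s (m≤n+m j fuel))
    by-test : (d : Dec (i < acc + g j)) → blockSearch-step f i j (acc + g j) fuel d ≡ blockSearch-step g i j (acc + g j) fuel d
    by-test (yes _) = refl
    by-test (no _) = blockSearch-cong f g i h fuel (suc j) (acc + g j) (trans (+-suc fuel j) eq)

  blockIndex-cong : ∀ f g i → (∀ l → l < i → f l ≡ g l) → blockIndex f i ≡ blockIndex g i
  blockIndex-cong f g i h = blockSearch-cong f g i h i 0 0 (+-identityʳ i)

  letters : Bool → ℕ → ℕ
  letters true = alt 1 b
  letters false = alt b 1

  -- approx n c applies Δ⁻¹ n times to 1^ω, alternating the first letter between 1 and b; its letter
  -- at l no longer changes once n > l, so the diagonal is the limit pair M = Δ⁻¹₁(ΔM), ΔM = Δ⁻¹_b(M).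
  approx : ℕ → Bool → Word
  approx zero c i = 1
  approx (suc n) c i = letters c (blockIndex (approx n (not c)) i)

  approx-stable : ∀ n n' c l → l < n → l < n' → approx n c l ≡ approx n' c l
  approx-stable (suc n) (suc n') c l l< l<' = cong (letters c) (blockIndex-cong _ _ l (λ l' l'< →
    approx-stable n n' (not c) l' (<-≤-trans l'< (≤-pred l<)) (<-≤-trans l'< (≤-pred l<'))))

  diagonal : Bool → Word
  diagonal c i = approx (suc i) c i

  M : Word
  M = diagonal true

  ΔM : Word
  ΔM = diagonal false

  alt-over : ∀ α β i → (α ≡ 1 ⊎ α ≡ b) → (β ≡ 1 ⊎ β ≡ b) → alt α β i ≡ 1 ⊎ alt α β i ≡ b
  alt-over α β zero oa ob = oa
  alt-over α β (suc i) oa ob = alt-over β α i ob oa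

  letters-over : ∀ c i → letters c i ≡ 1 ⊎ letters c i ≡ b
  letters-over true i = alt-over 1 b i (inj₁ refl) (inj₂ refl)
  letters-over false i = alt-over b 1 i (inj₂ refl) (inj₁ refl)

  diagonal-over : ∀ c → OverAB 1 b (diagonal c)
  diagonal-over c i = letters-over c _

  letters-alt : ∀ c k → letters c k ≡ alt (letters c 0) (letters c 1) k
  letters-alt true k = refl
  letters-alt false k = refl

  runs-diagonal : ∀ c → Runs (letters c 0) (letters c 1) (diagonal (not c)) (diagonal c)
  runs-diagonal c = mkRuns (over-pos (diagonal-over (not c))) letter
    where
    U : Word
    U = diagonal (not c)
    letter : ∀ k t → t < U k → diagonal c (S U k + t) ≡ alt (letters c 0) (letters c 1) k
    letter k t t< = trans (cong (letters c) (trans (blockIndex-cong _ _ i agree) bk)) (letters-alt c k)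
      where
      i : ℕ
      i = S U k + t
      agree : ∀ l → l < i → approx i (not c) l ≡ U l
      agree l l< = approx-stable i (suc l) (not c) l l< ≤-refl
      bk : blockIndex U i ≡ k
      bk = inBlock-unique U i _ k (blockIndex-inBlock U (over-pos (diagonal-over (not c))) i)
          (m≤m+n (S U k) t , +-monoʳ-< (S U k) t<)

  runs-M : Runs 1 b ΔM M
  runs-M = runs-diagonal true

  runs-ΔM : Runs b 1 M ΔM
  runs-ΔM = runs-diagonal false

  Tower : (ℕ → Word) → Set
  Tower W = (∀ l → OverAB 1 b (W l)) × (∀ l → IsΔ1b (W l) (W (suc l)))

  smooth⇒tower : ∀ {w} → Smooth 1 b w → Σ (ℕ → Word) λ W → Tower W × W 0 ≈w w
  smooth⇒tower (W , W0≈w , over , isDelta) = W , (over , isΔ) , W0≈w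
    where
    isΔ : ∀ l → IsΔ1b (W l) (W (suc l))
    isΔ l with isDelta l
    ... | inj₁ d = inj₁ (toRuns {1} {b} {W (suc l)} {W l} d)
    ... | inj₂ d = inj₂ (toRuns {b} {1} {W (suc l)} {W l} d)

  tower⇒smooth : ∀ {W} → Tower W → Smooth 1 b (W 0)
  tower⇒smooth {W} (over , isΔ) = W , (λ _ → refl) , over , isDelta
    where
    isDelta : ∀ l → IsDelta 1 b (W l) (W (suc l))
    isDelta l with isΔ l
    ... | inj₁ r = inj₁ (fromRuns r)
    ... | inj₂ r = inj₂ (fromRuns r)

  towerM : ℕ → Word
  towerM zero = M
  towerM (suc zero) = ΔM
  towerM (suc (suc l)) = towerM l

  tower-M : Tower towerM
  tower-M = over , isΔ
    where
    over : ∀ l → OverAB 1 b (towerM l)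
    over zero = diagonal-over true
    over (suc zero) = diagonal-over false
    over (suc (suc l)) = over l
    isΔ : ∀ l → IsΔ1b (towerM l) (towerM (suc l))
    isΔ zero = inj₁ runs-M
    isΔ (suc zero) = inj₂ runs-ΔM
    isΔ (suc (suc l)) = isΔ l

  towerM-head : ∀ l → towerM l 0 ≡ (if even l then 1 else b)
  towerM-head zero = runs-head runs-M
  towerM-head (suc zero) = runs-head runs-ΔM
  towerM-head (suc (suc l)) rewrite not-involutive (even l) = towerM-head l

  towerM-head-by : ∀ l {c} → even l ≡ c → towerM l 0 ≡ (if c then 1 else b)
  towerM-head-by l e = trans (towerM-head l) (cong (if_then 1 else b) e)

  tower-agree : ∀ {W W'} → Tower W → Tower W' → ∀ N l → (∀ i → i ≤ N → W (l + i) 0 ≡ W' (l + i) 0) →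
    ∀ q → q ≤ N → W l q ≡ W' l q
  tower-agree {W} {W'} tW tW' zero l heads q q≤ =
    subst (λ q → W l q ≡ W' l q) (sym (n≤0⇒n≡0 q≤)) (subst (λ z → W z 0 ≡ W' z 0) (+-identityʳ l) (heads 0 z≤n))
  tower-agree {W} {W'} tW tW' (suc N) l heads q q≤ = by-head (proj₁ tW l 0)
    where
    head-l : W l 0 ≡ W' l 0
    head-l = subst (λ z → W z 0 ≡ W' z 0) (+-identityʳ l) (heads 0 z≤n)
    above : ∀ q → q ≤ N → W (suc l) q ≡ W' (suc l) q
    above = tower-agree tW tW' N (suc l) (λ i i≤ → subst (λ z → W z 0 ≡ W' z 0) (+-suc l i) (heads (suc i) (s≤s i≤)))
    by-head : (W l 0 ≡ 1) ⊎ (W l 0 ≡ b) → W l q ≡ W' l q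
    by-head (inj₁ e) = runs-agree N (isΔ-head-1 (proj₂ tW l) e) (isΔ-head-1 (proj₂ tW' l) (trans (sym head-l) e)) above q q≤
    by-head (inj₂ e) = runs-agree N (isΔ-head-b (proj₂ tW l) e) (isΔ-head-b (proj₂ tW' l) (trans (sym head-l) e)) above q q≤

  tower-heads⇒≈ : ∀ {W W'} → Tower W → Tower W' → (∀ l → W l 0 ≡ W' l 0) → W 0 ≈w W' 0
  tower-heads⇒≈ tW tW' heads q = tower-agree tW tW' q 0 (λ i _ → heads i) q ≤-refl

  LexOrAlt : Bool → Word → Word → Set
  LexOrAlt true x y = x <lex y
  LexOrAlt false x y = x <alt y

  -- A first difference between the heads of level l + k of the two towers gives the comparison
  -- LexOrAlt (even l) at level l: Δ⁻¹₁ turns <alt into <lex, and Δ⁻¹_b turns <lex into <alt.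
  tower-M-below : ∀ {W} → Tower W → ∀ k l → (∀ i → i < k → towerM (l + i) 0 ≡ W (l + i) 0) →
    towerM (l + k) 0 ≢ W (l + k) 0 → LexOrAlt (even l) (towerM l) (W l)
  tower-M-below {W} tW zero l _ ne = by-parity (even l) refl (proj₁ tW l 0)
    where
    differ : towerM l 0 ≢ W l 0
    differ eq = ne (subst (λ z → towerM z 0 ≡ W z 0) (sym (+-identityʳ l)) eq)
    by-parity : ∀ c → even l ≡ c → (W l 0 ≡ 1) ⊎ (W l 0 ≡ b) → LexOrAlt c (towerM l) (W l)
    by-parity true e (inj₂ Wl0≡b) = <lex-1b 0 Agree-zero (towerM-head-by l e) Wl0≡b
    by-parity false e (inj₁ Wl0≡1) = 0 , Agree-zero , AltBefore-even refl Wl0≡1 (towerM-head-by l e)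
    by-parity true e (inj₁ Wl0≡1) = ⊥-elim (differ (trans (towerM-head-by l e) (sym Wl0≡1)))
    by-parity false e (inj₂ Wl0≡b) = ⊥-elim (differ (trans (towerM-head-by l e) (sym Wl0≡b)))
  tower-M-below {W} tW (suc k) l same ne = by-parity (even l) refl
    where
    same-l : towerM l 0 ≡ W l 0
    same-l = subst (λ z → towerM z 0 ≡ W z 0) (+-identityʳ l) (same 0 (s≤s z≤n))
    above : LexOrAlt (not (even l)) (towerM (suc l)) (W (suc l))
    above = tower-M-below tW k (suc l) (λ i i< → subst (λ z → towerM z 0 ≡ W z 0) (+-suc l i) (same (suc i) (s≤s i<)))
                                       (λ eq → ne (subst (λ z → towerM z 0 ≡ W z 0) (sym (+-suc l k)) eq))
    by-parity : ∀ c → even l ≡ c → LexOrAlt c (towerM l) (W l)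
    by-parity true e = runs-1b-<alt⇒<lex (isΔ-head-1 (proj₂ tower-M l) head) (isΔ-head-1 (proj₂ tW l) (trans (sym same-l) head))
                         (subst (λ c → LexOrAlt c (towerM (suc l)) (W (suc l))) (cong not e) above)
      where
      head : towerM l 0 ≡ 1
      head = towerM-head-by l e
    by-parity false e = runs-b1-<lex⇒<alt (isΔ-head-b (proj₂ tower-M l) head) (isΔ-head-b (proj₂ tW l) (trans (sym same-l) head))
                          (over-odd (proj₁ tower-M (suc l))) (subst (λ c → LexOrAlt c (towerM (suc l)) (W (suc l))) (cong not e) above)
      where
      head : towerM l 0 ≡ b
      head = towerM-head-by l e

  ¬tower<lex-M : ∀ {W} → Tower W → ¬ (W 0 <lex M)
  ¬tower<lex-M {W} tW (n , agree , lt) with first-difference (λ l → towerM l 0) (λ l → W l 0) n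
  ... | inj₁ same = <-irrefl (sym (tower-agree tower-M tW n 0 same n ≤-refl)) lt
  ... | inj₂ (k , _ , same , ne) = <lex-asym (n , agree , lt) (tower-M-below tW k 0 same ne)

  smooth-M : Smooth 1 b M
  smooth-M = tower⇒smooth tower-M

  minSmooth≈M : ∀ {m} → IsMinSmooth 1 b m → m ≈w M
  minSmooth≈M (sm , minimal) with minimal M smooth-M | smooth⇒tower sm
  ... | inj₂ m≈M | _ = m≈M
  ... | inj₁ m<M | W , tW , W0≈m = ⊥-elim (¬tower<lex-M tW (<lex-cong (λ i → sym (W0≈m i)) (λ _ → refl) m<M))

  module FixedM = FixedPoint runs-M runs-ΔM (diagonal-over true) (diagonal-over false)

  AltLyndon-M : AltLyndon M
  AltLyndon-M = AltLyndon-Δ⁻¹ runs-M (diagonal-over false) (runs-head runs-ΔM) FixedM.odd-P≡1 FixedM.AltLyndon-P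

  module LyndonTower {W : ℕ → Word} (tW : Tower W) where
    private
      over : ∀ l → OverAB 1 b (W l)
      over = proj₁ tW
      isΔ : ∀ l → IsΔ1b (W l) (W (suc l))
      isΔ = proj₂ tW

    LyndonLevel : ℕ → Set
    LyndonLevel l = Lyndon (W l) × (W l 0 ≡ 1) × (W (suc l) 0 ≡ b)

    LyndonLevel-+2 : ∀ l → LyndonLevel l → LyndonLevel (suc (suc l))
    LyndonLevel-+2 l (ly , head₀ , head₁) = AltLyndon⇒Lyndon r₂ (over l₃) alt₃ , head₂ , head₃
      where
      l₃ : ℕ
      l₃ = suc (suc (suc l))
      alt₁ : AltLyndon (W (suc l))
      alt₁ = Lyndon⇒AltLyndon (isΔ-head-1 (isΔ l) head₀) (over (suc l)) ly
      r₁ : Runs b 1 (W (suc (suc l))) (W (suc l))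
      r₁ = isΔ-head-b (isΔ (suc l)) head₁
      head₂ : W (suc (suc l)) 0 ≡ 1
      head₂ = AltLyndon⇒Δ-head≡1 r₁ (over (suc (suc l))) alt₁
      tail₂ : TailLyndon (W (suc (suc l)))
      tail₂ = AltLyndon⇒TailLyndon-Δ r₁ (over (suc (suc l))) alt₁ head₂
      r₂ : Runs 1 b (W l₃) (W (suc (suc l)))
      r₂ = isΔ-head-1 (isΔ (suc (suc l))) head₂
      head₃ : W l₃ 0 ≡ b
      head₃ = TailLyndon⇒Δ-head≡b tail₂ r₂ (over l₃) (isΔ l₃) (over (suc l₃)) (isΔ (suc l₃)) (over (suc (suc l₃)))
      alt₃ : AltLyndon (W l₃)
      alt₃ = TailLyndon⇒AltLyndon-Δ r₂ (over l₃) tail₂ head₃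

    LyndonLevel-even : LyndonLevel 0 → ∀ i → LyndonLevel (i + i)
    LyndonLevel-even g zero = g
    LyndonLevel-even g (suc i) = subst LyndonLevel (cong suc (sym (+-suc i i))) (LyndonLevel-+2 (i + i) (LyndonLevel-even g i))

    LyndonLevel⇒≈M : LyndonLevel 0 → W 0 ≈w M
    LyndonLevel⇒≈M g = tower-heads⇒≈ tW tower-M heads
      where
      heads : ∀ l → W l 0 ≡ towerM l 0
      heads l with half l
      ... | i , inj₁ refl = trans (proj₁ (proj₂ (LyndonLevel-even g i))) (sym (towerM-head-by (i + i) (even-double i)))
      ... | i , inj₂ refl = trans (proj₂ (proj₂ (LyndonLevel-even g i)))
          (sym (towerM-head-by (suc (i + i)) (cong not (even-double i))))

  smooth-Lyndon⇒M : ∀ {w} → Smooth 1 b w → Lyndon w → (w ≈w M) ⊎ Runs 1 b M w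
  smooth-Lyndon⇒M sw lyw with smooth⇒tower sw
  ... | W , tW@(over , isΔ) , W0≈w = by-Δ-head (over 1 0)
    where
    ly : Lyndon (W 0)
    ly = Lyndon-cong (λ i → sym (W0≈w i)) lyw
    r₀ : Runs 1 b (W 1) (W 0)
    r₀ = isΔ-head-1 (isΔ 0) (Lyndon-head 1<b (over 0) ly)
    by-Δ-head : (W 1 0 ≡ 1) ⊎ (W 1 0 ≡ b) → (_ ≈w M) ⊎ Runs 1 b M _
    by-Δ-head (inj₂ head₁) = inj₁ (λ i → trans (sym (W0≈w i)) (LyndonTower.LyndonLevel⇒≈M tW (ly , runs-head r₀ , head₁) i))
    by-Δ-head (inj₁ head₁) = inj₂ (Runs-cong r₀ (LyndonTower.LyndonLevel⇒≈M tW₁ (Lyndon-W₁ , head₁ , head₂)) W0≈w)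
      where
      tW₁ : Tower (λ l → W (suc l))
      tW₁ = (λ l → over (suc l)) , (λ l → isΔ (suc l))
      alt₁ : AltLyndon (W 1)
      alt₁ = Lyndon⇒AltLyndon r₀ (over 1) ly
      r₁ : Runs 1 b (W 2) (W 1)
      r₁ = isΔ-head-1 (isΔ 1) head₁
      head₂ : W 2 0 ≡ b
      head₂ with over 2 0
      ... | inj₂ e = e
      ... | inj₁ e = ⊥-elim (AltLyndon⇒Δ²-head≢1 r₁ (over 2) alt₁ (isΔ 2) (over 3) e)
      Lyndon-W₁ : Lyndon (W 1)
      Lyndon-W₁ = AltLyndon⇒Lyndon r₁ (over 2) (AltLyndon-Δ r₁ (over 2) alt₁)

  runs-over : ∀ {U X} → Runs 1 b U X → OverAB 1 b X
  runs-over {U} {X} r q with blockOf U (runs-pos r) q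
  ... | j , bj = subst (λ z → z ≡ 1 ⊎ z ≡ b) (sym (runs-letter-inBlock r q j bj)) (alt-over 1 b j (inj₁ refl) (inj₂ refl))

  M⇒smooth-Lyndon : ∀ {w} → (w ≈w M) ⊎ Runs 1 b M w → Smooth 1 b w × Lyndon w
  M⇒smooth-Lyndon (inj₁ w≈M) = Smooth-cong (λ i → sym (w≈M i)) smooth-M , Lyndon-cong (λ i → sym (w≈M i)) FixedM.Lyndon-M
  M⇒smooth-Lyndon {w} (inj₂ r) = tower⇒smooth tW , AltLyndon⇒Lyndon r (diagonal-over true) AltLyndon-M
    where
    W : ℕ → Word
    W zero = w
    W (suc l) = towerM l
    tW : Tower W
    tW = over , isΔ
      where
      over : ∀ l → OverAB 1 b (W l)
      over zero = runs-over r
      over (suc l) = proj₁ tower-M l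
      isΔ : ∀ l → IsΔ1b (W l) (W (suc l))
      isΔ zero = inj₁ r
      isΔ (suc l) = proj₂ tower-M l

  smooth-Lyndon⇔ : ∀ {m} → IsMinSmooth 1 b m → ∀ w → (Smooth 1 b w × Lyndon w) ⇔ ((w ≈w m) ⊎ InvDelta 1 b m w)
  smooth-Lyndon⇔ {m} min w = mk⇔ to from
    where
    m≈M : m ≈w M
    m≈M = minSmooth≈M min
    to : Smooth 1 b w × Lyndon w → (w ≈w m) ⊎ InvDelta 1 b m w
    to (sw , lyw) with smooth-Lyndon⇒M sw lyw
    ... | inj₁ w≈M = inj₁ (λ i → trans (w≈M i) (sym (m≈M i)))
    ... | inj₂ r = inj₂ (fromRuns (Runs-cong r (λ i → sym (m≈M i)) (λ _ → refl)))
    from : (w ≈w m) ⊎ InvDelta 1 b m w → Smooth 1 b w × Lyndon w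
    from (inj₁ w≈m) = M⇒smooth-Lyndon (inj₁ (λ i → trans (w≈m i) (m≈M i)))
    from (inj₂ d) = M⇒smooth-Lyndon (inj₂ (Runs-cong (toRuns {1} {b} {m} {w} d) m≈M (λ _ → refl)))

theorem20 : (a b : ℕ) → Odd a → Odd b → a < b →
    ((∃ λ w → Smooth a b w × Lyndon w) ⇔ (a ≡ 1))
    × (a ≡ 1 → (m : Word) → IsMinSmooth a b m →
        (w : Word) → (Smooth a b w × Lyndon w) ⇔ ((w ≈w m) ⊎ InvDelta a b m w))
theorem20 a b odd-a odd-b a<b = mk⇔ exists⇒a≡1 a≡1⇒exists , a≡1⇒classification
  where
  a-odd : even a ≡ false
  a-odd = Odd⇒¬even odd-a
  b-odd : even b ≡ false
  b-odd = Odd⇒¬even odd-b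
  3≤b : 3 ≤ b
  3≤b = odd-≢1⇒≥3 b b-odd (λ b≡1 → <-irrefl (sym b≡1) (≤-<-trans (odd⇒≥1 a a-odd) a<b))
  exists⇒a≡1 : (∃ λ w → Smooth a b w × Lyndon w) → a ≡ 1
  exists⇒a≡1 (w , sw , lyw) with a ≟ 1
  ... | yes a≡1 = a≡1
  ... | no a≢1 = ⊥-elim (WithoutOne.¬smooth-Lyndon a b a-odd b-odd a<b a≢1 sw lyw)
  a≡1⇒exists : a ≡ 1 → ∃ λ w → Smooth a b w × Lyndon w
  a≡1⇒exists refl = WithOne.M b b-odd 3≤b , WithOne.smooth-M b b-odd 3≤b , WithOne.FixedM.Lyndon-M b b-odd 3≤b
  a≡1⇒classification : a ≡ 1 → (m : Word) → IsMinSmooth a b m → (w : Word) → (Smooth a b w × Lyndon w) ⇔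
      ((w ≈w m) ⊎ InvDelta a b m w)
  a≡1⇒classification refl m min = WithOne.smooth-Lyndon⇔ b b-odd 3≤b min
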